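{- Let $n\ge 1$ and let $F=[\ell_1,\ell_2,\ldots,\ell_s]$ be a $2$-regular graph of order $2n+1$ satisfying: (1) $V(F)=(\{0,1\}\times\mathbb{Z}_n)\cup\{\infty\}$; (2) the two vertices adjacent to $\infty$ are of the form $(0,x_0)$ and $(1,x_1)$ for some $x_0,x_1\in\mathbb{Z}_n$; (3) if $n$ is odd, then $\Delta_{00}F=\Delta_{11}F=\mathbb{Z}_n\setminus\{0\}$ and $\Delta_{01}F=\mathbb{Z}_n$; (4) if $n$ is even, then (a) $F$ contains the path $P=\lfloor (0,0),(0,n/2),(1,n/2),(1,0)\rfloor$ in one of its cycles, and (b) $\Delta_{ij}(F-P)=\mathbb{Z}_n\setminus\{0,n/2\}$ for every $(i,j)\in\{(0,0),(0,1),(1,1)\}$. Then there exists a solution of $OP([\ell_1,\ell_2,\ldots,\ell_s])$. Furthermore, if $C$ is an $\ell_1$-cycle of $F$ such that $\Delta_{01}C$ contains an integer distinct from $n/2$, then there exists a solution to $OP([\ell_1+1,\ell_2,\ldots,\ell_s])$.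
   Context: For $v\ge3$, $K_v^*$ denotes $K_v$ if $v$ is odd and $K_v$ minus a $1$-factor (perfect matching) if $v$ is even. $[\ell_1,\dots,\ell_s]$ denotes a $2$-regular graph that is a disjoint union of cycles of lengths $\ell_1,\dots,\ell_s$. For a $2$-regular graph $F$ of order $v$, the Oberwolfach problem $OP(F)$ asks for a decomposition of the edge set of $K_v^*$ into edge-disjoint spanning $2$-regular subgraphs each isomorphic to $F$; such a decomposition is a solution to $OP(F)$. The notation $\lfloor a,b,c,d\rfloor$ denotes the path with consecutive vertices $a,b,c,d$, and $F-P$ denotes the graph obtained from $F$ by deleting the edges of $P$. For a graph $\Gamma$ with vertex set contained in $(\{0,1\}\times\mathbb{Z}_n)\cup\{\infty\}$ and $i,j\in\{0,1\}$, $\Delta_{ij}\Gamma$ is the multiset of all differences $x-y\in\mathbb{Z}_n$ taken over all ordered pairs of adjacent vertices $((i,x),(j,y))$ of $\Gamma$ (vertices different from $\infty$); in particular for $i=j$ each such edge contributes both $x-y$ and $y-x$, while $\Delta_{01}\Gamma$ contains, for each edge between $(0,x)$ and $(1,y)$, only the difference $x-y$. Equalities of these multisets with sets mean every element of the set occurs exactly once. -}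

module Defs where

open import Data.Nat using (ℕ; zero; suc; _+_; _≤_)
open import Data.Nat.Divisibility using (_∣_)
open import Data.Fin using (Fin; toℕ) renaming (zero to fzero; suc to fsuc)
open import Data.List using (List; length; lookup; _∷_)
open import Data.Nat.ListAction using (sum)
open import Data.List.Relation.Unary.All using (All)
open import Data.Product using (Σ; ∃; _×_; _,_)
open import Data.Sum using (_⊎_)
open import Relation.Nullary using (¬_)
open import Relation.Binary.PropositionalEquality using (_≡_; _≢_)
open import Function.Bundles using (_↔_; Inverse; _⇔_)

Graph : Set → Set₁
Graph V = V → V → Set

record IsSimple {V : Set} (G : Graph V) : Set where
  field
    sym   : ∀ {u w} → G u w → G w u
    irrefl : ∀ {u} → ¬ G u u

_≅_ : {V W : Set} → Graph V → Graph W → Set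
_≅_ {V} {W} G H =
  Σ (V ↔ W) λ f → ∀ x y → G x y ⇔ H (Inverse.to f x) (Inverse.to f y)

CycAdjℕ : ℕ → ℕ → ℕ → Set
CycAdjℕ ℓ a b =
  (b ≡ suc a) ⊎ (a ≡ suc b) ⊎ (suc a ≡ ℓ × b ≡ 0) ⊎ (suc b ≡ ℓ × a ≡ 0)

CycAdjFin : (ℓ : ℕ) → Fin ℓ → Fin ℓ → Set
CycAdjFin ℓ a b = CycAdjℕ ℓ (toℕ a) (toℕ b)

-- the canonical 2-regular graph [ℓ₁,…,ℓₛ]: vertices (i , a) with a ∈ Fin ℓᵢ
CycVtx : List ℕ → Set
CycVtx L = Σ (Fin (length L)) (λ i → Fin (lookup L i))

Cyc : (L : List ℕ) → Graph (CycVtx L)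
Cyc L (i , a) (j , b) = (toℕ i ≡ toℕ j) × CycAdjℕ (lookup L i) (toℕ a) (toℕ b)

CycleLengths : List ℕ → Set
CycleLengths L = All (3 ≤_) L

-- M is the edge set removed from K_v to obtain K_v^*:
-- empty if v is odd, a 1-factor (perfect matching) if v is even
IsRemovedFactor : (v : ℕ) → Graph (Fin v) → Set
IsRemovedFactor v M =
  (¬ (2 ∣ v) → ∀ u w → ¬ M u w) ×
  (2 ∣ v → IsSimple M ×
           (∀ u → ∃ λ w → M u w) ×
           (∀ u w w′ → M u w → M u w′ → w ≡ w′))

-- a solution to OP([ℓ₁,…,ℓₛ]) : a decomposition of the edge set of K_v^*
-- (v = ℓ₁+…+ℓₛ, vertex set Fin v) into edge-disjoint spanning subgraphs
-- each isomorphic to [ℓ₁,…,ℓₛ]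
record OPSolution (L : List ℕ) : Set₁ where
  field
    removed  : Graph (Fin (sum L))
    removedOK : IsRemovedFactor (sum L) removed
    k        : ℕ
    factor   : Fin k → Graph (Fin (sum L))
    factorSimple : ∀ i → IsSimple (factor i)
    factorIso : ∀ i → factor i ≅ Cyc L
    cover    : ∀ u w → u ≢ w → ¬ removed u w → ∃ λ i → factor i u w
    avoid    : ∀ i u w → factor i u w → ¬ removed u w
    disjoint : ∀ i j u w → factor i u w → factor j u w → i ≡ j

OP : List ℕ → Set₁
OP L = OPSolution L

data Vtx (n : ℕ) : Set where
  ∞  : Vtx n
  pt : Fin 2 → Fin n → Vtx n

𝟘 𝟙 : Fin 2
𝟘 = fzero
𝟙 = fsuc fzero

-- x - y ≡ d in ℤₙ (elements of ℤₙ represented by Fin n)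
DiffIs : (n : ℕ) → Fin n → Fin n → Fin n → Set
DiffIs n x y d = (toℕ y + toℕ d ≡ toℕ x) ⊎ (toℕ y + toℕ d ≡ toℕ x + n)

-- the multiset Δᵢⱼ G (over ordered pairs ((i,x),(j,y)) of adjacent vertices,
-- difference x - y) equals the set S: every element of S occurs exactly
-- once, every element outside S does not occur
ΔIs : (n : ℕ) → Graph (Vtx n) → Fin 2 → Fin 2 → (Fin n → Set) → Set
ΔIs n G i j S = ∀ d →
  (S d → (∃ λ x → ∃ λ y → G (pt i x) (pt j y) × DiffIs n x y d) ×
         (∀ x y x′ y′ → G (pt i x) (pt j y) → DiffIs n x y d →
                        G (pt i x′) (pt j y′) → DiffIs n x′ y′ d →
                        (x ≡ x′ × y ≡ y′))) ×
  (¬ S d → ∀ x y → G (pt i x) (pt j y) → ¬ DiffIs n x y d)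

PEdge : (n : ℕ) → Fin n → Fin n → Vtx n → Vtx n → Set
PEdge n z h u w =
  ((u ≡ pt 𝟘 z) × (w ≡ pt 𝟘 h)) ⊎ ((w ≡ pt 𝟘 z) × (u ≡ pt 𝟘 h)) ⊎
  ((u ≡ pt 𝟘 h) × (w ≡ pt 𝟙 h)) ⊎ ((w ≡ pt 𝟘 h) × (u ≡ pt 𝟙 h)) ⊎
  ((u ≡ pt 𝟙 h) × (w ≡ pt 𝟙 z)) ⊎ ((w ≡ pt 𝟙 h) × (u ≡ pt 𝟙 z))

_minusP_ : {n : ℕ} → Graph (Vtx n) → (Fin n × Fin n) → Graph (Vtx n)
_minusP_ {n} G (z , h) u w = G u w × ¬ PEdge n z h u w

record CycleIn {V : Set} (G : Graph V) (ℓ : ℕ) : Set where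
  field
    c     : Fin ℓ → V
    inj   : ∀ a b → c a ≡ c b → a ≡ b
    edges : ∀ a b → CycAdjFin ℓ a b → G (c a) (c b)

InΔ01 : {n : ℕ} {G : Graph (Vtx n)} {ℓ : ℕ} → CycleIn G ℓ → Fin n → Set
InΔ01 {n} {G} {ℓ} C d = ∃ λ a → ∃ λ b → ∃ λ x → ∃ λ y →
  CycAdjFin ℓ a b × CycleIn.c C a ≡ pt 𝟘 x × CycleIn.c C b ≡ pt 𝟙 y × DiffIs n x y d

module Submission where

-- The 2-factors are the preimages F ∘ ψᵢ (i ∈ ℤₙ) of F under permutations ψᵢ of the vertices that
-- fix ∞. For n odd, ψᵢ is the translation x ↦ x − i on both levels: a pair {(s,a),(t,b)} is an
-- edge of F ∘ ψᵢ iff {(s,a−i),(t,b−i)} is an edge of F, and the difference conditions say that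
-- exactly one edge of F has the difference a − b, so exactly one i works; the two edges at ∞ take
-- care of the pairs {∞,(s,a)}. For n even the edges of F − P are treated alike, while the pairs
-- with difference 0 or n/2 come from P: for i ≥ n/2 the translation is followed by exchanging the
-- two vertices at position n/2, which turns the two level edges of P into cross edges, so that the
-- images of P cover each of these pairs exactly once.
-- For the second statement, subdivide an edge {(0,x),(1,y)} of the ℓ₁-cycle by a new vertex ∞′.
-- Every finite vertex is sent into {(0,x),(1,y)} by exactly one ψᵢ, so {∞,∞′} and the pairs
-- ψᵢ⁻¹{(0,x),(1,y)} form a 1-factor of K_{2n+2}, and the subdivided factors decompose the rest.

open import Defs
open import Level using (0ℓ)
open import Algebra.Bundles using (AbelianGroup)
open import Algebra.Structures using (IsAbelianGroup)
import Algebra.Properties.AbelianGroup as AbelianGroupProperties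
open import Data.Nat using (ℕ; zero; suc; _+_; _∸_; _≤_; _<_; s≤s; z≤n; NonZero)
import Data.Nat.Properties as ℕ
open import Data.Nat.Divisibility using (_∣_; _∣?_; divides; ∣m+n∣m⇒∣n; ∣1⇒≡1)
open import Data.Nat.DivMod using (_%_; _mod_; m%n<n; n%n≡0; m%n%n≡m%n; m<n⇒m%n≡m; %-distribˡ-+; [m+n]%n≡m%n)
open import Data.Nat.ListAction using (sum)
open import Data.Fin using (Fin; toℕ; fromℕ; fromℕ<; opposite; splitAt; join) renaming (zero to fzero; suc to fsuc)
open import Data.Fin.Properties
  using (_≟_; toℕ-injective; toℕ<n; toℕ-fromℕ; toℕ-fromℕ<; fromℕ<-toℕ; injective⇒≤; opposite-involutive; +↔⊎; splitAt-join; join-splitAt)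
open import Data.Fin.Permutation using (↔⇒≡)
open import Data.List using (List; []; _∷_; length; lookup)
open import Data.List.Relation.Unary.All using (_∷_)
open import Data.Maybe using (Maybe; just; nothing)
import Data.Maybe as Maybe
open import Data.Unit using (⊤; tt)
open import Data.Empty using (⊥; ⊥-elim)
open import Data.Sum using (_⊎_; inj₁; inj₂) renaming (swap to ⊎-swap; map to ⊎-map)
open import Data.Sum.Function.Propositional using (_⊎-↔_)
open import Data.Product using (Σ; ∃; _×_; _,_; proj₁; proj₂; swap)
open import Function.Base using (_on_; _∘_)
open import Function.Bundles using (_↔_; Inverse; Injection; mk↔ₛ′; _⇔_; Equivalence; mk⇔)
open import Function.Construct.Composition using (_↔-∘_)
open import Function.Construct.Identity using (↔-id)
open import Function.Construct.Symmetry using (↔-sym)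
open import Function.Properties.Inverse using (↔⇒↣)
open import Relation.Nullary using (¬_; Dec; yes; no)
open import Relation.Nullary.Decidable using (map′; ¬?; _×-dec_; _⊎-dec_)
open import Relation.Binary.PropositionalEquality

-- Arithmetic modulo n

%-absorbˡ : ∀ d .{{_ : NonZero d}} k l → (k % d + l) % d ≡ (k + l) % d
%-absorbˡ d k l = begin
  (k % d + l) % d            ≡⟨ %-distribˡ-+ (k % d) l d ⟩
  (k % d % d + l % d) % d    ≡⟨ cong (λ x → (x + l % d) % d) (m%n%n≡m%n k d) ⟩
  (k % d + l % d) % d        ≡⟨ %-distribˡ-+ k l d ⟨
  (k + l) % d                ∎
  where open ≡-Reasoning

%-absorbʳ : ∀ d .{{_ : NonZero d}} k l → (k + l % d) % d ≡ (k + l) % d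
%-absorbʳ d k l = begin
  (k + l % d) % d  ≡⟨ cong (_% d) (ℕ.+-comm k (l % d)) ⟩
  (l % d + k) % d  ≡⟨ %-absorbˡ d l k ⟩
  (l + k) % d      ≡⟨ cong (_% d) (ℕ.+-comm l k) ⟩
  (k + l) % d      ∎
  where open ≡-Reasoning

%-wrap : ∀ d .{{_ : NonZero d}} k → k < d + d → (k % d ≡ k) ⊎ (k % d + d ≡ k)
%-wrap d k k<2d with k ℕ.<? d
... | yes k<d = inj₁ (m<n⇒m%n≡m k<d)
... | no k≮d = inj₂ (begin
  k % d + d              ≡⟨ cong (λ x → x % d + d) (ℕ.m∸n+n≡m d≤k) ⟨
  (k ∸ d + d) % d + d    ≡⟨ cong (_+ d) ([m+n]%n≡m%n (k ∸ d) d) ⟩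
  (k ∸ d) % d + d        ≡⟨ cong (_+ d) (m<n⇒m%n≡m k∸d<d) ⟩
  k ∸ d + d              ≡⟨ ℕ.m∸n+n≡m d≤k ⟩
  k                      ∎)
  where
  open ≡-Reasoning
  d≤k : d ≤ k
  d≤k = ℕ.≮⇒≥ k≮d
  k∸d<d : k ∸ d < d
  k∸d<d = ℕ.+-cancelʳ-< d (k ∸ d) d (subst (_< d + d) (sym (ℕ.m∸n+n≡m d≤k)) k<2d)

half-of-even : ∀ {n} → 2 ∣ suc n → Σ (Fin (suc n)) λ h → toℕ h + toℕ h ≡ suc n
half-of-even {n} (divides k n+1≡k*2) = fromℕ< k<n+1 , trans (cong (λ x → x + x) (toℕ-fromℕ< k<n+1)) k+k≡n+1
  where
  k+k≡n+1 : k + k ≡ suc n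
  k+k≡n+1 = sym (trans n+1≡k*2 (trans (ℕ.*-comm k 2) (cong (k +_) (ℕ.+-identityʳ k))))
  k<n+1 : k < suc n
  k<n+1 = subst (k <_) k+k≡n+1 (ℕ.m<m+n k (ℕ.n≢0⇒n>0 (λ k≡0 → ℕ.1+n≢0 (trans (sym k+k≡n+1) (cong (λ x → x + x) k≡0)))))

module Cyclic (m : ℕ) where

  N : ℕ
  N = suc m

  Z : Set
  Z = Fin N

  0z : Z
  0z = fzero

  infixl 6 _⊕_ _⊖_
  infix 8 ⊝_

  toℕ-mod : ∀ k → toℕ (k mod N) ≡ k % N
  toℕ-mod k = toℕ-fromℕ< (m%n<n k N)

  opaque
    _⊕_ : Z → Z → Z
    a ⊕ b = (toℕ a + toℕ b) mod N

    ⊝_ : Z → Z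
    ⊝ a = (N ∸ toℕ a) mod N

    toℕ-⊕ : ∀ a b → toℕ (a ⊕ b) ≡ (toℕ a + toℕ b) % N
    toℕ-⊕ a b = toℕ-mod (toℕ a + toℕ b)

    toℕ-⊝ : ∀ a → toℕ (⊝ a) ≡ (N ∸ toℕ a) % N
    toℕ-⊝ a = toℕ-mod (N ∸ toℕ a)

    ⊕-comm : ∀ a b → a ⊕ b ≡ b ⊕ a
    ⊕-comm a b = cong (_mod N) (ℕ.+-comm (toℕ a) (toℕ b))

  _⊖_ : Z → Z → Z
  a ⊖ b = a ⊕ ⊝ b

  ⊕-assoc : ∀ a b c → (a ⊕ b) ⊕ c ≡ a ⊕ (b ⊕ c)
  ⊕-assoc a b c = toℕ-injective (begin
    toℕ ((a ⊕ b) ⊕ c)                  ≡⟨ toℕ-⊕ (a ⊕ b) c ⟩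
    (toℕ (a ⊕ b) + toℕ c) % N          ≡⟨ cong (λ x → (x + toℕ c) % N) (toℕ-⊕ a b) ⟩
    ((toℕ a + toℕ b) % N + toℕ c) % N  ≡⟨ %-absorbˡ N (toℕ a + toℕ b) (toℕ c) ⟩
    (toℕ a + toℕ b + toℕ c) % N        ≡⟨ cong (_% N) (ℕ.+-assoc (toℕ a) (toℕ b) (toℕ c)) ⟩
    (toℕ a + (toℕ b + toℕ c)) % N      ≡⟨ %-absorbʳ N (toℕ a) (toℕ b + toℕ c) ⟨
    (toℕ a + (toℕ b + toℕ c) % N) % N  ≡⟨ cong (λ x → (toℕ a + x) % N) (toℕ-⊕ b c) ⟨
    (toℕ a + toℕ (b ⊕ c)) % N          ≡⟨ toℕ-⊕ a (b ⊕ c) ⟨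
    toℕ (a ⊕ (b ⊕ c))                  ∎)
    where open ≡-Reasoning

  ⊕-identityˡ : ∀ a → 0z ⊕ a ≡ a
  ⊕-identityˡ a = toℕ-injective (trans (toℕ-⊕ 0z a) (m<n⇒m%n≡m (toℕ<n a)))

  ⊕-identityʳ : ∀ a → a ⊕ 0z ≡ a
  ⊕-identityʳ a = trans (⊕-comm a 0z) (⊕-identityˡ a)

  ⊕-inverseʳ : ∀ a → a ⊕ ⊝ a ≡ 0z
  ⊕-inverseʳ a = toℕ-injective (begin
    toℕ (a ⊕ ⊝ a)                  ≡⟨ toℕ-⊕ a (⊝ a) ⟩
    (toℕ a + toℕ (⊝ a)) % N        ≡⟨ cong (λ x → (toℕ a + x) % N) (toℕ-⊝ a) ⟩
    (toℕ a + (N ∸ toℕ a) % N) % N  ≡⟨ %-absorbʳ N (toℕ a) (N ∸ toℕ a) ⟩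
    (toℕ a + (N ∸ toℕ a)) % N      ≡⟨ cong (_% N) (ℕ.m+[n∸m]≡n (ℕ.<⇒≤ (toℕ<n a))) ⟩
    N % N                          ≡⟨ n%n≡0 N ⟩
    0                              ∎)
    where open ≡-Reasoning

  ⊕-inverseˡ : ∀ a → ⊝ a ⊕ a ≡ 0z
  ⊕-inverseˡ a = trans (⊕-comm (⊝ a) a) (⊕-inverseʳ a)

  ⊕-isAbelianGroup : IsAbelianGroup _≡_ _⊕_ 0z ⊝_
  ⊕-isAbelianGroup = record
    { isGroup = record
      { isMonoid = record
        { isSemigroup = record
          { isMagma = record { isEquivalence = isEquivalence ; ∙-cong = cong₂ _⊕_ }
          ; assoc = ⊕-assoc }
        ; identity = ⊕-identityˡ , ⊕-identityʳ }
      ; inverse = ⊕-inverseˡ , ⊕-inverseʳ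
      ; ⁻¹-cong = cong ⊝_ }
    ; comm = ⊕-comm }

  ⊕-abelianGroup : AbelianGroup 0ℓ 0ℓ
  ⊕-abelianGroup = record { isAbelianGroup = ⊕-isAbelianGroup }

  open AbelianGroupProperties ⊕-abelianGroup public
    using (∙-cancelˡ; ∙-cancelʳ; //-rightDividesˡ; //-rightDividesʳ; ⁻¹-injective; x∙y⁻¹≈ε⇒x≈y; ⁻¹-anti-homo‿-)

  ⊖-⊕-cancel : ∀ a b → a ⊖ b ⊕ b ≡ a
  ⊖-⊕-cancel a b = //-rightDividesˡ b a

  ⊕-⊖-cancel : ∀ a b → a ⊕ b ⊖ b ≡ a
  ⊕-⊖-cancel a b = //-rightDividesʳ b a

  ⊖-self : ∀ a → a ⊖ a ≡ 0z
  ⊖-self = ⊕-inverseʳ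

  ⊖≡0⇒≡ : ∀ {a b} → a ⊖ b ≡ 0z → a ≡ b
  ⊖≡0⇒≡ = x∙y⁻¹≈ε⇒x≈y _ _

  toℕ-⊖≡0⇒≡ : ∀ {a b} → toℕ (a ⊖ b) ≡ 0 → a ≡ b
  toℕ-⊖≡0⇒≡ eq = ⊖≡0⇒≡ (toℕ-injective {j = 0z} eq)

  ⊖-cancelˡ : ∀ a {u v} → a ⊖ u ≡ a ⊖ v → u ≡ v
  ⊖-cancelˡ a eq = ⁻¹-injective (∙-cancelˡ a _ _ eq)

  ⊖-cancelʳ : ∀ c {a b} → a ⊖ c ≡ b ⊖ c → a ≡ b
  ⊖-cancelʳ c eq = ∙-cancelʳ (⊝ c) _ _ eq

  ⊝-⊖ : ∀ a b → ⊝ (a ⊖ b) ≡ b ⊖ a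
  ⊝-⊖ = ⁻¹-anti-homo‿-

  ⊖-⊖-cancel : ∀ a b → a ⊖ (a ⊖ b) ≡ b
  ⊖-⊖-cancel a b = ⊖-cancelʳ (a ⊖ b) (begin
    a ⊖ (a ⊖ b) ⊖ (a ⊖ b)  ≡⟨ cong (_⊕ ⊝ (a ⊖ b)) (cong (a ⊕_) (⊝-⊖ a b)) ⟩
    a ⊕ (b ⊖ a) ⊖ (a ⊖ b)  ≡⟨ cong (_⊖ (a ⊖ b)) (⊕-comm a (b ⊖ a)) ⟩
    b ⊖ a ⊕ a ⊖ (a ⊖ b)    ≡⟨ cong (_⊖ (a ⊖ b)) (⊖-⊕-cancel b a) ⟩
    b ⊖ (a ⊖ b)            ∎)
    where open ≡-Reasoning

  ⊖-translate : ∀ a b i → (a ⊖ i) ⊖ (b ⊖ i) ≡ a ⊖ b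
  ⊖-translate a b i = begin
    a ⊖ i ⊕ ⊝ (b ⊖ i)    ≡⟨ cong (a ⊖ i ⊕_) (⊝-⊖ b i) ⟩
    a ⊖ i ⊕ (i ⊖ b)      ≡⟨ ⊕-assoc a (⊝ i) (i ⊖ b) ⟩
    a ⊕ (⊝ i ⊕ (i ⊖ b))  ≡⟨ cong (a ⊕_) (⊕-assoc (⊝ i) i (⊝ b)) ⟨
    a ⊕ (⊝ i ⊕ i ⊖ b)    ≡⟨ cong (λ x → a ⊕ (x ⊖ b)) (⊕-inverseˡ i) ⟩
    a ⊕ (0z ⊖ b)         ≡⟨ cong (a ⊕_) (⊕-identityˡ (⊝ b)) ⟩
    a ⊖ b                ∎
    where open ≡-Reasoning

  toℕ-⊕-wrap : ∀ a b → (toℕ (a ⊕ b) ≡ toℕ a + toℕ b) ⊎ (toℕ (a ⊕ b) + N ≡ toℕ a + toℕ b)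
  toℕ-⊕-wrap a b rewrite toℕ-⊕ a b = %-wrap N (toℕ a + toℕ b) (ℕ.+-mono-< (toℕ<n a) (toℕ<n b))

  ⊕≡⇒DiffIs : ∀ {x y d} → y ⊕ d ≡ x → DiffIs N x y d
  ⊕≡⇒DiffIs {y = y} {d} refl with toℕ-⊕-wrap y d
  ... | inj₁ eq = inj₁ (sym eq)
  ... | inj₂ eq = inj₂ (sym eq)

  DiffIs⇒⊕≡ : ∀ {x y d} → DiffIs N x y d → y ⊕ d ≡ x
  DiffIs⇒⊕≡ {x} {y} {d} diff = toℕ-injective (begin
    toℕ (y ⊕ d)        ≡⟨ toℕ-⊕ y d ⟩
    (toℕ y + toℕ d) % N ≡⟨ reduce diff ⟩
    toℕ x % N          ≡⟨ m<n⇒m%n≡m (toℕ<n x) ⟩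
    toℕ x              ∎)
    where
    open ≡-Reasoning
    reduce : DiffIs N x y d → (toℕ y + toℕ d) % N ≡ toℕ x % N
    reduce (inj₁ eq) = cong (_% N) eq
    reduce (inj₂ eq) = trans (cong (_% N) eq) ([m+n]%n≡m%n (toℕ x) N)

  DiffIs⇒≡⊖ : ∀ {x y d} → DiffIs N x y d → d ≡ x ⊖ y
  DiffIs⇒≡⊖ {x} {y} {d} diff = begin
    d          ≡⟨ ⊕-⊖-cancel d y ⟨
    d ⊕ y ⊖ y  ≡⟨ cong (_⊖ y) (trans (⊕-comm d y) (DiffIs⇒⊕≡ {x} {y} {d} diff)) ⟩
    x ⊖ y      ∎
    where open ≡-Reasoning

  DiffIs-⊖ : ∀ x y → DiffIs N x y (x ⊖ y)
  DiffIs-⊖ x y = ⊕≡⇒DiffIs {x} {y} (trans (⊕-comm y (x ⊖ y)) (⊖-⊕-cancel x y))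

  module Half (h : Z) (h+h≡N : toℕ h + toℕ h ≡ N) where

    half≢0 : h ≢ 0z
    half≢0 h≡0 = ℕ.0≢1+n (trans (cong (λ x → toℕ x + toℕ x) (sym h≡0)) h+h≡N)

    ⊝half : ⊝ h ≡ h
    ⊝half = toℕ-injective (begin
      toℕ (⊝ h)          ≡⟨ toℕ-⊝ h ⟩
      (N ∸ toℕ h) % N    ≡⟨ cong (λ x → (x ∸ toℕ h) % N) h+h≡N ⟨
      (toℕ h + toℕ h ∸ toℕ h) % N ≡⟨ cong (_% N) (ℕ.m+n∸n≡m (toℕ h) (toℕ h)) ⟩
      toℕ h % N          ≡⟨ m<n⇒m%n≡m (toℕ<n h) ⟩
      toℕ h              ∎)
      where open ≡-Reasoning

    ⊖≡half-sym : ∀ a b → a ⊖ b ≡ h → b ⊖ a ≡ h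
    ⊖≡half-sym a b eq = trans (sym (⊝-⊖ a b)) (trans (cong ⊝_ eq) ⊝half)

    Low : Z → Set
    Low a = toℕ a < toℕ h

    low? : ∀ a → Dec (Low a)
    low? a = toℕ a ℕ.<? toℕ h

    low-xor-⊕half : ∀ a → (Low a × ¬ Low (a ⊕ h)) ⊎ (¬ Low a × Low (a ⊕ h))
    low-xor-⊕half a with toℕ-⊕-wrap a h
    ... | inj₁ eq = inj₁ (a<h , λ a⊕h<h → ℕ.m+n≮n (toℕ a) (toℕ h) (subst (_< toℕ h) eq a⊕h<h))
      where
      a<h : Low a
      a<h = ℕ.+-cancelʳ-< (toℕ h) (toℕ a) (toℕ h) (subst₂ _<_ eq (sym h+h≡N) (toℕ<n (a ⊕ h)))
    ... | inj₂ eq = inj₂ ((λ a<h → ℕ.m+n≮n r (toℕ h) (subst (_< toℕ h) a≡r+h a<h)) , r<h)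
      where
      r : ℕ
      r = toℕ (a ⊕ h)
      a≡r+h : toℕ a ≡ r + toℕ h
      a≡r+h = ℕ.+-cancelʳ-≡ (toℕ h) (toℕ a) (r + toℕ h)
        (trans (sym eq) (trans (cong (r +_) (sym h+h≡N)) (sym (ℕ.+-assoc r (toℕ h) (toℕ h)))))
      r<h : Low (a ⊕ h)
      r<h = ℕ.+-cancelʳ-< (toℕ h) r (toℕ h) (subst₂ _<_ a≡r+h (sym h+h≡N) (toℕ<n a))

    low-xor-⊖≡half : ∀ a b → b ⊖ a ≡ h → (Low a × ¬ Low b) ⊎ (¬ Low a × Low b)
    low-xor-⊖≡half a b eq = subst (λ v → (Low a × ¬ Low v) ⊎ (¬ Low a × Low v)) b≡a⊕h (low-xor-⊕half a)
      where
      b≡a⊕h : a ⊕ h ≡ b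
      b≡a⊕h = trans (cong (a ⊕_) (sym eq)) (trans (⊕-comm a (b ⊖ a)) (⊖-⊕-cancel b a))

-- Graphs of maximum degree two and the 2-regular graphs [ℓ₁,…,ℓₛ]

to-injective : {A B : Set} (f : A ↔ B) {x y : A} → Inverse.to f x ≡ Inverse.to f y → x ≡ y
to-injective f = Injection.injective (↔⇒↣ f)

≅-trans : {U V W : Set} {F : Graph U} {G : Graph V} {H : Graph W} → F ≅ G → G ≅ H → F ≅ H
≅-trans (f , F⇔G) (g , G⇔H) = g ↔-∘ f , λ x y →
  mk⇔ (λ e → Equivalence.to (G⇔H _ _) (Equivalence.to (F⇔G x y) e))
      (λ e → Equivalence.from (F⇔G x y) (Equivalence.from (G⇔H _ _) e))

≅-respˡ : {V W : Set} {G G′ : Graph V} {H : Graph W} → (∀ x y → G x y ⇔ G′ x y) → G ≅ H → G′ ≅ H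
≅-respˡ G⇔G′ (f , G⇔H) = f , λ x y →
  mk⇔ (λ e → Equivalence.to (G⇔H x y) (Equivalence.from (G⇔G′ x y) e))
      (λ e → Equivalence.to (G⇔G′ x y) (Equivalence.from (G⇔H x y) e))

MaxDegree2 : {V : Set} → Graph V → Set
MaxDegree2 {V} G = ∀ {x y₁ y₂ y₃ : V} → G x y₁ → G x y₂ → G x y₃ → (y₁ ≡ y₂) ⊎ (y₁ ≡ y₃) ⊎ (y₂ ≡ y₃)

third-neighbour : {V : Set} {G : Graph V} → MaxDegree2 G →
  ∀ {x a b c} → G x a → G x b → a ≢ b → G x c → (c ≡ a) ⊎ (c ≡ b)
third-neighbour deg ga gb a≢b gc with deg ga gb gc
... | inj₁ a≡b = ⊥-elim (a≢b a≡b)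
... | inj₂ (inj₁ a≡c) = inj₁ (sym a≡c)
... | inj₂ (inj₂ b≡c) = inj₂ (sym b≡c)

≅-maxDegree2 : {V W : Set} {G : Graph V} {H : Graph W} → G ≅ H → MaxDegree2 H → MaxDegree2 G
≅-maxDegree2 (f , G⇔H) deg {x} {y₁} {y₂} {y₃} e₁ e₂ e₃
  with deg (Equivalence.to (G⇔H x y₁) e₁) (Equivalence.to (G⇔H x y₂) e₂) (Equivalence.to (G⇔H x y₃) e₃)
... | inj₁ eq = inj₁ (to-injective f eq)
... | inj₂ (inj₁ eq) = inj₂ (inj₁ (to-injective f eq))
... | inj₂ (inj₂ eq) = inj₂ (inj₂ (to-injective f eq))

data Direction : Set where
  forward backward : Direction

direction : ∀ {ℓ a b} → CycAdjℕ ℓ a b → Direction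
direction (inj₁ _) = forward
direction (inj₂ (inj₁ _)) = backward
direction (inj₂ (inj₂ (inj₁ _))) = forward
direction (inj₂ (inj₂ (inj₂ _))) = backward

direction-injective : ∀ {ℓ a b b′} → b < ℓ → b′ < ℓ → (p : CycAdjℕ ℓ a b) (q : CycAdjℕ ℓ a b′) →
  direction p ≡ direction q → b ≡ b′
direction-injective _ _ (inj₁ refl) (inj₁ refl) _ = refl
direction-injective b<ℓ _ (inj₁ refl) (inj₂ (inj₂ (inj₁ (refl , _)))) _ = ⊥-elim (ℕ.n≮n _ b<ℓ)
direction-injective _ b′<ℓ (inj₂ (inj₂ (inj₁ (refl , _)))) (inj₁ refl) _ = ⊥-elim (ℕ.n≮n _ b′<ℓ)
direction-injective _ _ (inj₂ (inj₂ (inj₁ (_ , refl)))) (inj₂ (inj₂ (inj₁ (_ , refl)))) _ = refl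
direction-injective _ _ (inj₂ (inj₁ p)) (inj₂ (inj₁ q)) _ = ℕ.suc-injective (trans (sym p) q)
direction-injective _ _ (inj₂ (inj₁ refl)) (inj₂ (inj₂ (inj₂ (_ , ())))) _
direction-injective _ _ (inj₂ (inj₂ (inj₂ (_ , ())))) (inj₂ (inj₁ refl)) _
direction-injective _ _ (inj₂ (inj₂ (inj₂ (p , _)))) (inj₂ (inj₂ (inj₂ (q , _)))) _ = ℕ.suc-injective (trans p (sym q))
direction-injective _ _ (inj₁ _) (inj₂ (inj₁ _)) ()
direction-injective _ _ (inj₁ _) (inj₂ (inj₂ (inj₂ _))) ()
direction-injective _ _ (inj₂ (inj₁ _)) (inj₁ _) ()
direction-injective _ _ (inj₂ (inj₁ _)) (inj₂ (inj₂ (inj₁ _))) ()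
direction-injective _ _ (inj₂ (inj₂ (inj₁ _))) (inj₂ (inj₁ _)) ()
direction-injective _ _ (inj₂ (inj₂ (inj₁ _))) (inj₂ (inj₂ (inj₂ _))) ()
direction-injective _ _ (inj₂ (inj₂ (inj₂ _))) (inj₁ _) ()
direction-injective _ _ (inj₂ (inj₂ (inj₂ _))) (inj₂ (inj₂ (inj₁ _))) ()

two-of-three-directions : ∀ (d₁ d₂ d₃ : Direction) → (d₁ ≡ d₂) ⊎ (d₁ ≡ d₃) ⊎ (d₂ ≡ d₃)
two-of-three-directions forward forward _ = inj₁ refl
two-of-three-directions backward backward _ = inj₁ refl
two-of-three-directions forward backward forward = inj₂ (inj₁ refl)
two-of-three-directions forward backward backward = inj₂ (inj₂ refl)
two-of-three-directions backward forward forward = inj₂ (inj₂ refl)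
two-of-three-directions backward forward backward = inj₂ (inj₁ refl)

CycVtx-≡ : ∀ {L : List ℕ} {i j : Fin (length L)} {a : Fin (lookup L i)} {b : Fin (lookup L j)} →
  toℕ i ≡ toℕ j → toℕ a ≡ toℕ b → _≡_ {A = CycVtx L} (i , a) (j , b)
CycVtx-≡ {L} {i} {j} {a} {b} i≡j a≡b with toℕ-injective {i = i} {j = j} i≡j
... | refl with toℕ-injective {i = a} {j = b} a≡b
...   | refl = refl

Cyc-direction-injective : ∀ {L} {x y y′ : CycVtx L} (p : Cyc L x y) (q : Cyc L x y′) →
  direction (proj₂ p) ≡ direction (proj₂ q) → y ≡ y′
Cyc-direction-injective {L} {i , a} {j , b} {j′ , b′} (i≡j , p) (i≡j′ , q) eq
  with toℕ-injective {i = i} {j = j} i≡j | toℕ-injective {i = i} {j = j′} i≡j′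
... | refl | refl = CycVtx-≡ {L} refl (direction-injective (toℕ<n b) (toℕ<n b′) p q eq)

Cyc-maxDegree2 : ∀ L → MaxDegree2 (Cyc L)
Cyc-maxDegree2 L p q r with two-of-three-directions (direction (proj₂ p)) (direction (proj₂ q)) (direction (proj₂ r))
... | inj₁ eq = inj₁ (Cyc-direction-injective {L} p q eq)
... | inj₂ (inj₁ eq) = inj₂ (inj₁ (Cyc-direction-injective {L} p r eq))
... | inj₂ (inj₂ eq) = inj₂ (inj₂ (Cyc-direction-injective {L} q r eq))

CycVtx↔Fin : ∀ L → CycVtx L ↔ Fin (sum L)
CycVtx↔Fin [] = mk↔ₛ′ (λ { (() , _) }) (λ ()) (λ ()) (λ { (() , _) })
CycVtx↔Fin (ℓ ∷ L) = ↔-sym (+↔⊎ {ℓ} {sum L}) ↔-∘ ((↔-id (Fin ℓ) ⊎-↔ CycVtx↔Fin L) ↔-∘ split)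
  where
  split : CycVtx (ℓ ∷ L) ↔ (Fin ℓ ⊎ CycVtx L)
  split = mk↔ₛ′ to from (λ { (inj₁ _) → refl ; (inj₂ _) → refl }) (λ { (fzero , _) → refl ; (fsuc _ , _) → refl })
    where
    to : CycVtx (ℓ ∷ L) → Fin ℓ ⊎ CycVtx L
    to (fzero , a) = inj₁ a
    to (fsuc i , a) = inj₂ (i , a)
    from : Fin ℓ ⊎ CycVtx L → CycVtx (ℓ ∷ L)
    from (inj₁ a) = fzero , a
    from (inj₂ (i , a)) = fsuc i , a

Vtx↔Fin : ∀ n → Vtx n ↔ Fin (suc (n + n))
Vtx↔Fin n = mk↔ₛ′ to from to-from from-to
  where
  to : Vtx n → Fin (suc (n + n))
  to ∞ = fzero
  to (pt fzero x) = fsuc (join n n (inj₁ x))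
  to (pt (fsuc fzero) x) = fsuc (join n n (inj₂ x))
  level : Fin n ⊎ Fin n → Vtx n
  level (inj₁ x) = pt 𝟘 x
  level (inj₂ x) = pt 𝟙 x
  from : Fin (suc (n + n)) → Vtx n
  from fzero = ∞
  from (fsuc y) = level (splitAt n y)
  to-level : ∀ s → to (level s) ≡ fsuc (join n n s)
  to-level (inj₁ _) = refl
  to-level (inj₂ _) = refl
  to-from : ∀ y → to (from y) ≡ y
  to-from fzero = refl
  to-from (fsuc y) = trans (to-level (splitAt n y)) (cong fsuc (join-splitAt n n y))
  from-to : ∀ x → from (to x) ≡ x
  from-to ∞ = refl
  from-to (pt fzero x) = cong level (splitAt-join n n (inj₁ x))
  from-to (pt (fsuc fzero) x) = cong level (splitAt-join n n (inj₂ x))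

Maybe-↔ : {A B : Set} → A ↔ B → Maybe A ↔ Maybe B
Maybe-↔ f = mk↔ₛ′ (Maybe.map (Inverse.to f)) (Maybe.map (Inverse.from f)) to-from from-to
  where
  to-from : ∀ y → Maybe.map (Inverse.to f) (Maybe.map (Inverse.from f) y) ≡ y
  to-from nothing = refl
  to-from (just y) = cong just (Inverse.strictlyInverseˡ f y)
  from-to : ∀ x → Maybe.map (Inverse.from f) (Maybe.map (Inverse.to f) x) ≡ x
  from-to nothing = refl
  from-to (just x) = cong just (Inverse.strictlyInverseʳ f x)

Maybe-Fin↔Fin : ∀ k → Maybe (Fin k) ↔ Fin (suc k)
Maybe-Fin↔Fin k = mk↔ₛ′ (Maybe.maybe fsuc fzero) from
  (λ { fzero → refl ; (fsuc _) → refl }) (λ { nothing → refl ; (just _) → refl })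
  where
  from : Fin (suc k) → Maybe (Fin k)
  from fzero = nothing
  from (fsuc a) = just a

order-≅ : ∀ {V n L} {G : Graph V} → V ↔ Fin n → G ≅ Cyc L → sum L ≡ n
order-≅ {L = L} V↔n (f , _) = ↔⇒≡ (V↔n ↔-∘ (↔-sym f ↔-∘ ↔-sym (CycVtx↔Fin L)))

2∣n+n : ∀ n → 2 ∣ n + n
2∣n+n n = divides n (trans (cong (n +_) (sym (ℕ.+-identityʳ n))) (ℕ.*-comm 2 n))

2∤1+n+n : ∀ n → ¬ (2 ∣ suc (n + n))
2∤1+n+n n 2∣1+n+n with ∣1⇒≡1 (∣m+n∣m⇒∣n (subst (2 ∣_) (ℕ.+-comm 1 (n + n)) 2∣1+n+n) (2∣n+n n))
... | ()

2∣2+n+n : ∀ n → 2 ∣ suc (suc (n + n))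
2∣2+n+n n = subst (2 ∣_) (cong suc (ℕ.+-suc n n)) (2∣n+n (suc n))

IsRemovedFactorOn : {V : Set} → ℕ → Graph V → Set
IsRemovedFactorOn v M =
  (¬ (2 ∣ v) → ∀ u w → ¬ M u w) ×
  (2 ∣ v → IsSimple M ×
           (∀ u → ∃ λ w → M u w) ×
           (∀ u w w′ → M u w → M u w′ → w ≡ w′))

IsSimple-on : {V W : Set} {G : Graph W} (f : V → W) → IsSimple G → IsSimple (G on f)
IsSimple-on f G-simple = record { sym = IsSimple.sym G-simple ; irrefl = IsSimple.irrefl G-simple }

IsRemovedFactorOn-on : {V W : Set} {v : ℕ} {M : Graph V} (f : W ↔ V) →
  IsRemovedFactorOn v M → IsRemovedFactorOn v (M on Inverse.to f)
IsRemovedFactorOn-on {M = M} f (odd , even) =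
  (λ 2∤v u w → odd 2∤v _ _) ,
  (λ 2∣v → let (simple , perfect , unique) = even 2∣v in
     IsSimple-on _ simple ,
     (λ u → let (w , e) = perfect (Inverse.to f u) in
       Inverse.from f w , subst (M (Inverse.to f u)) (sym (Inverse.strictlyInverseˡ f w)) e) ,
     (λ u w w′ e e′ → to-injective f (unique _ _ _ e e′)))

record PermutationSolution (L : List ℕ) (V : Set) : Set₁ where
  field
    base       : Graph V
    baseSimple : IsSimple base
    baseIso    : base ≅ Cyc L
    k          : ℕ
    ψ          : Fin k → V ↔ V
    removed    : Graph V
    removedOK  : IsRemovedFactorOn (sum L) removed
    cover      : ∀ u w → u ≢ w → ¬ removed u w → ∃ λ i → (base on Inverse.to (ψ i)) u w
    avoid      : ∀ i u w → (base on Inverse.to (ψ i)) u w → ¬ removed u w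
    disjoint   : ∀ i j u w → (base on Inverse.to (ψ i)) u w → (base on Inverse.to (ψ j)) u w → i ≡ j

PermutationSolution⇒OP : ∀ {L V} → PermutationSolution L V → OP L
PermutationSolution⇒OP {L} {V} S = record
  { removed = removed on fromFin
  ; removedOK = IsRemovedFactorOn-on (↔-sym V↔Fin) removedOK
  ; k = k
  ; factor = λ i → base on (Inverse.to (ψ i) ∘ fromFin)
  ; factorSimple = λ i → IsSimple-on _ baseSimple
  ; factorIso = λ i → proj₁ baseIso ↔-∘ (ψ i ↔-∘ ↔-sym V↔Fin) , λ _ _ → proj₂ baseIso _ _
  ; cover = λ a b a≢b → cover (fromFin a) (fromFin b) (λ eq → a≢b (fromFin-injective eq))
  ; avoid = λ i a b → avoid i (fromFin a) (fromFin b)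
  ; disjoint = λ i j a b → disjoint i j (fromFin a) (fromFin b)
  }
  where
  open PermutationSolution S
  V↔Fin : V ↔ Fin (sum L)
  V↔Fin = CycVtx↔Fin L ↔-∘ proj₁ baseIso
  fromFin : Fin (sum L) → V
  fromFin = Inverse.from V↔Fin
  fromFin-injective : ∀ {a b} → fromFin a ≡ fromFin b → a ≡ b
  fromFin-injective = to-injective (↔-sym V↔Fin)

-- Translations and the difference method

module Translation (m : ℕ) where
  open Cyclic m

  translate : Z → Vtx N → Vtx N
  translate i ∞ = ∞
  translate i (pt s x) = pt s (x ⊖ i)

  translate-↔ : Z → Vtx N ↔ Vtx N
  translate-↔ i = mk↔ₛ′ (translate i) untranslate to-from from-to
    where
    untranslate : Vtx N → Vtx N
    untranslate ∞ = ∞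
    untranslate (pt s x) = pt s (x ⊕ i)
    to-from : ∀ v → translate i (untranslate v) ≡ v
    to-from ∞ = refl
    to-from (pt s x) = cong (pt s) (⊕-⊖-cancel x i)
    from-to : ∀ v → untranslate (translate i v) ≡ v
    from-to ∞ = refl
    from-to (pt s x) = cong (pt s) (⊖-⊕-cancel x i)

  pt-injectiveˡ : ∀ {s s′ a b} → pt {N} s a ≡ pt s′ b → s ≡ s′
  pt-injectiveˡ refl = refl

  pt-injectiveʳ : ∀ {s s′ a b} → pt {N} s a ≡ pt s′ b → a ≡ b
  pt-injectiveʳ refl = refl

  IsEndOf : Z → Z → Vtx N → Set
  IsEndOf x y v = (v ≡ pt 𝟘 x) ⊎ (v ≡ pt 𝟙 y)

  translate-IsEndOf : ∀ x y u → u ≢ ∞ → ∃ λ i → IsEndOf x y (translate i u)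
  translate-IsEndOf x y ∞ u≢∞ = ⊥-elim (u≢∞ refl)
  translate-IsEndOf x y (pt fzero a) _ = a ⊖ x , inj₁ (cong (pt 𝟘) (⊖-⊖-cancel a x))
  translate-IsEndOf x y (pt (fsuc fzero) a) _ = a ⊖ y , inj₂ (cong (pt 𝟙) (⊖-⊖-cancel a y))

  translate-IsEndOf-unique : ∀ x y u i j → IsEndOf x y (translate i u) → IsEndOf x y (translate j u) → i ≡ j
  translate-IsEndOf-unique x y ∞ i j (inj₁ ()) _
  translate-IsEndOf-unique x y ∞ i j (inj₂ ()) _
  translate-IsEndOf-unique x y (pt s a) i j (inj₁ e) (inj₁ e′) = ⊖-cancelˡ a (trans (pt-injectiveʳ e) (sym (pt-injectiveʳ e′)))
  translate-IsEndOf-unique x y (pt s a) i j (inj₂ e) (inj₂ e′) = ⊖-cancelˡ a (trans (pt-injectiveʳ e) (sym (pt-injectiveʳ e′)))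
  translate-IsEndOf-unique x y (pt s a) i j (inj₁ e) (inj₂ e′) with trans (sym (pt-injectiveˡ e)) (pt-injectiveˡ e′)
  ... | ()
  translate-IsEndOf-unique x y (pt s a) i j (inj₂ e) (inj₁ e′) with trans (sym (pt-injectiveˡ e)) (pt-injectiveˡ e′)
  ... | ()

  module TranslatedDifferences (B : Graph (Vtx N)) (s s′ : Fin 2) (S : Z → Set) (S? : ∀ d → Dec (S d))
                               (Δ : ΔIs N B s s′ S) where

    DiffIs-translate : ∀ a b i → DiffIs N (a ⊖ i) (b ⊖ i) (a ⊖ b)
    DiffIs-translate a b i = subst (DiffIs N (a ⊖ i) (b ⊖ i)) (⊖-translate a b i) (DiffIs-⊖ (a ⊖ i) (b ⊖ i))

    translate-cover : ∀ a b → S (a ⊖ b) → ∃ λ i → B (pt s (a ⊖ i)) (pt s′ (b ⊖ i))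
    translate-cover a b Sd with proj₁ (proj₁ (Δ (a ⊖ b)) Sd)
    ... | x , y , e , diff = a ⊖ x , subst₂ (λ u v → B (pt s u) (pt s′ v)) (sym a⊖i≡x) (sym b⊖i≡y) e
      where
      a⊖i≡x : a ⊖ (a ⊖ x) ≡ x
      a⊖i≡x = ⊖-⊖-cancel a x
      b⊖i≡y : b ⊖ (a ⊖ x) ≡ y
      b⊖i≡y = ⊖-cancelˡ x (begin
        x ⊖ (b ⊖ (a ⊖ x))            ≡⟨ cong (_⊖ (b ⊖ (a ⊖ x))) a⊖i≡x ⟨
        a ⊖ (a ⊖ x) ⊖ (b ⊖ (a ⊖ x))  ≡⟨ ⊖-translate a b (a ⊖ x) ⟩
        a ⊖ b                        ≡⟨ DiffIs⇒≡⊖ diff ⟩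
        x ⊖ y                        ∎)
        where open ≡-Reasoning

    translate-difference : ∀ a b i → B (pt s (a ⊖ i)) (pt s′ (b ⊖ i)) → S (a ⊖ b)
    translate-difference a b i e with S? (a ⊖ b)
    ... | yes Sd = Sd
    ... | no ¬Sd = ⊥-elim (proj₂ (Δ (a ⊖ b)) ¬Sd (a ⊖ i) (b ⊖ i) e (DiffIs-translate a b i))

    translate-unique : ∀ a b i j → B (pt s (a ⊖ i)) (pt s′ (b ⊖ i)) → B (pt s (a ⊖ j)) (pt s′ (b ⊖ j)) → i ≡ j
    translate-unique a b i j e e′ = ⊖-cancelˡ a (proj₁ (proj₂ (proj₁ (Δ (a ⊖ b)) (translate-difference a b i e)) _ _ _ _
      e (DiffIs-translate a b i) e′ (DiffIs-translate a b j)))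

  module DifferenceMethod
    (B : Graph (Vtx N)) (B-sym : ∀ {u w} → B u w → B w u) (B-irrefl : ∀ {u} → ¬ B u u)
    (x₀ x₁ : Z) (∞x₀ : B ∞ (pt 𝟘 x₀)) (∞x₁ : B ∞ (pt 𝟙 x₁))
    (∞x₀-unique : ∀ {a} → B ∞ (pt 𝟘 a) → a ≡ x₀) (∞x₁-unique : ∀ {a} → B ∞ (pt 𝟙 a) → a ≡ x₁)
    (S₀₀ S₁₁ S₀₁ : Z → Set)
    (S₀₀? : ∀ d → Dec (S₀₀ d)) (S₁₁? : ∀ d → Dec (S₁₁ d)) (S₀₁? : ∀ d → Dec (S₀₁ d))
    (Δ₀₀ : ΔIs N B 𝟘 𝟘 S₀₀) (Δ₁₁ : ΔIs N B 𝟙 𝟙 S₁₁) (Δ₀₁ : ΔIs N B 𝟘 𝟙 S₀₁) where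

    module D₀₀ = TranslatedDifferences B 𝟘 𝟘 S₀₀ S₀₀? Δ₀₀
    module D₁₁ = TranslatedDifferences B 𝟙 𝟙 S₁₁ S₁₁? Δ₁₁
    module D₀₁ = TranslatedDifferences B 𝟘 𝟙 S₀₁ S₀₁? Δ₀₁

    -- Δ₀₁ records x − y for an edge {(0,x),(1,y)}, hence b ⊖ a for the pair ((1,a),(0,b)).
    Admissible : Vtx N → Vtx N → Set
    Admissible ∞ _ = ⊤
    Admissible (pt _ _) ∞ = ⊤
    Admissible (pt fzero a) (pt fzero b) = S₀₀ (a ⊖ b)
    Admissible (pt fzero a) (pt (fsuc fzero) b) = S₀₁ (a ⊖ b)
    Admissible (pt (fsuc fzero) a) (pt fzero b) = S₀₁ (b ⊖ a)
    Admissible (pt (fsuc fzero) a) (pt (fsuc fzero) b) = S₁₁ (a ⊖ b)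

    Admissible? : ∀ u w → Dec (Admissible u w)
    Admissible? ∞ _ = yes tt
    Admissible? (pt _ _) ∞ = yes tt
    Admissible? (pt fzero a) (pt fzero b) = S₀₀? (a ⊖ b)
    Admissible? (pt fzero a) (pt (fsuc fzero) b) = S₀₁? (a ⊖ b)
    Admissible? (pt (fsuc fzero) a) (pt fzero b) = S₀₁? (b ⊖ a)
    Admissible? (pt (fsuc fzero) a) (pt (fsuc fzero) b) = S₁₁? (a ⊖ b)

    translate-cover-∞ : ∀ s a → ∃ λ i → B ∞ (translate i (pt s a))
    translate-cover-∞ fzero a = a ⊖ x₀ , subst (λ v → B ∞ (pt 𝟘 v)) (sym (⊖-⊖-cancel a x₀)) ∞x₀
    translate-cover-∞ (fsuc fzero) a = a ⊖ x₁ , subst (λ v → B ∞ (pt 𝟙 v)) (sym (⊖-⊖-cancel a x₁)) ∞x₁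

    translate-cover : ∀ u w → u ≢ w → Admissible u w → ∃ λ i → B (translate i u) (translate i w)
    translate-cover ∞ ∞ u≢w _ = ⊥-elim (u≢w refl)
    translate-cover ∞ (pt s a) _ _ = translate-cover-∞ s a
    translate-cover (pt s a) ∞ _ _ with translate-cover-∞ s a
    ... | i , e = i , B-sym e
    translate-cover (pt fzero a) (pt fzero b) _ adm = D₀₀.translate-cover a b adm
    translate-cover (pt fzero a) (pt (fsuc fzero) b) _ adm = D₀₁.translate-cover a b adm
    translate-cover (pt (fsuc fzero) a) (pt fzero b) _ adm with D₀₁.translate-cover b a adm
    ... | i , e = i , B-sym e
    translate-cover (pt (fsuc fzero) a) (pt (fsuc fzero) b) _ adm = D₁₁.translate-cover a b adm

    translate-admissible : ∀ u w i → B (translate i u) (translate i w) → Admissible u w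
    translate-admissible ∞ _ _ _ = tt
    translate-admissible (pt _ _) ∞ _ _ = tt
    translate-admissible (pt fzero a) (pt fzero b) i e = D₀₀.translate-difference a b i e
    translate-admissible (pt fzero a) (pt (fsuc fzero) b) i e = D₀₁.translate-difference a b i e
    translate-admissible (pt (fsuc fzero) a) (pt fzero b) i e = D₀₁.translate-difference b a i (B-sym e)
    translate-admissible (pt (fsuc fzero) a) (pt (fsuc fzero) b) i e = D₁₁.translate-difference a b i e

    translate-unique-∞ : ∀ w i j → B ∞ (translate i w) → B ∞ (translate j w) → i ≡ j
    translate-unique-∞ ∞ _ _ e _ = ⊥-elim (B-irrefl e)
    translate-unique-∞ (pt fzero a) _ _ e e′ = ⊖-cancelˡ a (trans (∞x₀-unique e) (sym (∞x₀-unique e′)))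
    translate-unique-∞ (pt (fsuc fzero) a) _ _ e e′ = ⊖-cancelˡ a (trans (∞x₁-unique e) (sym (∞x₁-unique e′)))

    translate-unique : ∀ u w i j → B (translate i u) (translate i w) → B (translate j u) (translate j w) → i ≡ j
    translate-unique ∞ w i j e e′ = translate-unique-∞ w i j e e′
    translate-unique (pt s a) ∞ i j e e′ = translate-unique-∞ (pt s a) i j (B-sym e) (B-sym e′)
    translate-unique (pt fzero a) (pt fzero b) i j e e′ = D₀₀.translate-unique a b i j e e′
    translate-unique (pt fzero a) (pt (fsuc fzero) b) i j e e′ = D₀₁.translate-unique a b i j e e′
    translate-unique (pt (fsuc fzero) a) (pt fzero b) i j e e′ = D₀₁.translate-unique b a i j (B-sym e) (B-sym e′)
    translate-unique (pt (fsuc fzero) a) (pt (fsuc fzero) b) i j e e′ = D₁₁.translate-unique a b i j e e′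

-- Twisting the path P when n is even

flipIf : {P : Set} → Dec P → Fin 2 → Fin 2
flipIf (yes _) = opposite
flipIf (no _) s = s

flipIf-involutive : {P : Set} (d : Dec P) → ∀ s → flipIf d (flipIf d s) ≡ s
flipIf-involutive (yes _) = opposite-involutive
flipIf-involutive (no _) s = refl

flipIf-yes : {P : Set} (d : Dec P) → P → ∀ s → flipIf d s ≡ opposite s
flipIf-yes (yes _) _ s = refl
flipIf-yes (no ¬p) p s = ⊥-elim (¬p p)

flipIf-no : {P : Set} (d : Dec P) → ¬ P → ∀ s → flipIf d s ≡ s
flipIf-no (yes p) ¬p s = ⊥-elim (¬p p)
flipIf-no (no _) _ s = refl

opposite≢ : ∀ (s : Fin 2) → opposite s ≢ s
opposite≢ fzero ()
opposite≢ (fsuc fzero) ()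

≢⇒opposite : ∀ {s s′ : Fin 2} → s ≢ s′ → opposite s ≡ s′
≢⇒opposite {fzero} {fzero} s≢s′ = ⊥-elim (s≢s′ refl)
≢⇒opposite {fzero} {fsuc fzero} _ = refl
≢⇒opposite {fsuc fzero} {fzero} _ = refl
≢⇒opposite {fsuc fzero} {fsuc fzero} s≢s′ = ⊥-elim (s≢s′ refl)

module TwistedPath (m : ℕ) (h : Fin (suc m)) (h+h≡N : toℕ h + toℕ h ≡ suc m) where
  open Cyclic m
  open Half h h+h≡N
  open Translation m

  Ends : Z → Z → Set
  Ends c c′ = (c ≡ 0z × c′ ≡ h) ⊎ (c ≡ h × c′ ≡ 0z)

  OnPath : Vtx N → Vtx N → Set
  OnPath (pt s c) (pt s′ c′) = (s ≡ s′ × Ends c c′) ⊎ (s ≢ s′ × c ≡ h × c′ ≡ h)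
  OnPath _ _ = ⊥

  PEdge⇒OnPath : ∀ {u w} → PEdge N 0z h u w → OnPath u w
  PEdge⇒OnPath (inj₁ (refl , refl)) = inj₁ (refl , inj₁ (refl , refl))
  PEdge⇒OnPath (inj₂ (inj₁ (refl , refl))) = inj₁ (refl , inj₂ (refl , refl))
  PEdge⇒OnPath (inj₂ (inj₂ (inj₁ (refl , refl)))) = inj₂ ((λ ()) , refl , refl)
  PEdge⇒OnPath (inj₂ (inj₂ (inj₂ (inj₁ (refl , refl))))) = inj₂ ((λ ()) , refl , refl)
  PEdge⇒OnPath (inj₂ (inj₂ (inj₂ (inj₂ (inj₁ (refl , refl)))))) = inj₁ (refl , inj₂ (refl , refl))
  PEdge⇒OnPath (inj₂ (inj₂ (inj₂ (inj₂ (inj₂ (refl , refl)))))) = inj₁ (refl , inj₁ (refl , refl))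

  OnPath⇒PEdge : ∀ u w → OnPath u w → PEdge N 0z h u w
  OnPath⇒PEdge (pt fzero _) (pt fzero _) (inj₁ (_ , inj₁ (refl , refl))) = inj₁ (refl , refl)
  OnPath⇒PEdge (pt fzero _) (pt fzero _) (inj₁ (_ , inj₂ (refl , refl))) = inj₂ (inj₁ (refl , refl))
  OnPath⇒PEdge (pt (fsuc fzero) _) (pt (fsuc fzero) _) (inj₁ (_ , inj₁ (refl , refl))) = inj₂ (inj₂ (inj₂ (inj₂ (inj₂ (refl , refl)))))
  OnPath⇒PEdge (pt (fsuc fzero) _) (pt (fsuc fzero) _) (inj₁ (_ , inj₂ (refl , refl))) = inj₂ (inj₂ (inj₂ (inj₂ (inj₁ (refl , refl)))))
  OnPath⇒PEdge (pt fzero _) (pt (fsuc fzero) _) (inj₁ (() , _))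
  OnPath⇒PEdge (pt (fsuc fzero) _) (pt fzero _) (inj₁ (() , _))
  OnPath⇒PEdge (pt fzero _) (pt fzero _) (inj₂ (s≢s , _)) = ⊥-elim (s≢s refl)
  OnPath⇒PEdge (pt (fsuc fzero) _) (pt (fsuc fzero) _) (inj₂ (s≢s , _)) = ⊥-elim (s≢s refl)
  OnPath⇒PEdge (pt fzero _) (pt (fsuc fzero) _) (inj₂ (_ , refl , refl)) = inj₂ (inj₂ (inj₁ (refl , refl)))
  OnPath⇒PEdge (pt (fsuc fzero) _) (pt fzero _) (inj₂ (_ , refl , refl)) = inj₂ (inj₂ (inj₂ (inj₁ (refl , refl))))

  OnPath? : ∀ u w → Dec (OnPath u w)
  OnPath? ∞ _ = no λ ()
  OnPath? (pt _ _) ∞ = no λ ()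
  OnPath? (pt s c) (pt s′ c′) =
    ((s ≟ s′) ×-dec (((c ≟ 0z) ×-dec (c′ ≟ h)) ⊎-dec ((c ≟ h) ×-dec (c′ ≟ 0z))))
    ⊎-dec (¬? (s ≟ s′) ×-dec ((c ≟ h) ×-dec (c′ ≟ h)))

  PEdge? : ∀ u w → Dec (PEdge N 0z h u w)
  PEdge? u w = map′ (OnPath⇒PEdge u w) PEdge⇒OnPath (OnPath? u w)

  PEdge-sym : ∀ {u w} → PEdge N 0z h u w → PEdge N 0z h w u
  PEdge-sym (inj₁ e) = inj₂ (inj₁ e)
  PEdge-sym (inj₂ (inj₁ e)) = inj₁ e
  PEdge-sym (inj₂ (inj₂ (inj₁ e))) = inj₂ (inj₂ (inj₂ (inj₁ e)))
  PEdge-sym (inj₂ (inj₂ (inj₂ (inj₁ e)))) = inj₂ (inj₂ (inj₁ e))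
  PEdge-sym (inj₂ (inj₂ (inj₂ (inj₂ (inj₁ e))))) = inj₂ (inj₂ (inj₂ (inj₂ (inj₂ e))))
  PEdge-sym (inj₂ (inj₂ (inj₂ (inj₂ (inj₂ e))))) = inj₂ (inj₂ (inj₂ (inj₂ (inj₁ e))))

  -- For i ≥ n/2 the two vertices at position n/2 exchange levels after translating by i.
  side : Z → Z → Fin 2 → Fin 2
  side i c = flipIf (¬? (low? i) ×-dec (c ≟ h))

  side-involutive : ∀ i c s → side i c (side i c s) ≡ s
  side-involutive i c = flipIf-involutive (¬? (low? i) ×-dec (c ≟ h))

  side-low : ∀ {i} c s → Low i → side i c s ≡ s
  side-low {i} c s i-low = flipIf-no (¬? (low? i) ×-dec (c ≟ h)) (λ (i-high , _) → i-high i-low) s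

  side-≢half : ∀ {i c} s → c ≢ h → side i c s ≡ s
  side-≢half {i} {c} s c≢h = flipIf-no (¬? (low? i) ×-dec (c ≟ h)) (λ (_ , c≡h) → c≢h c≡h) s

  side-high-half : ∀ {i} s → ¬ Low i → side i h s ≡ opposite s
  side-high-half {i} s i-high = flipIf-yes (¬? (low? i) ×-dec (h ≟ h)) (i-high , refl) s

  side-injective : ∀ i c {s s′} → side i c s ≡ side i c s′ → s ≡ s′
  side-injective i c {s} {s′} eq = begin
    s                      ≡⟨ side-involutive i c s ⟨
    side i c (side i c s)  ≡⟨ cong (side i c) eq ⟩
    side i c (side i c s′) ≡⟨ side-involutive i c s′ ⟩
    s′                     ∎
    where open ≡-Reasoning

  twist : Z → Vtx N → Vtx N
  twist i ∞ = ∞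
  twist i (pt s a) = pt (side i (a ⊖ i) s) (a ⊖ i)

  twist-↔ : Z → Vtx N ↔ Vtx N
  twist-↔ i = mk↔ₛ′ (twist i) untwist to-from from-to
    where
    untwist : Vtx N → Vtx N
    untwist ∞ = ∞
    untwist (pt t c) = pt (side i c t) (c ⊕ i)
    to-from : ∀ v → twist i (untwist v) ≡ v
    to-from ∞ = refl
    to-from (pt t c) rewrite ⊕-⊖-cancel c i = cong (λ s → pt s c) (side-involutive i c t)
    from-to : ∀ v → untwist (twist i v) ≡ v
    from-to ∞ = refl
    from-to (pt s a) = cong₂ pt (side-involutive i (a ⊖ i) s) (⊖-⊕-cancel a i)

  twist-≢half : ∀ i s a → a ⊖ i ≢ h → twist i (pt s a) ≡ translate i (pt s a)
  twist-≢half i s a a⊖i≢h = cong (λ t → pt t (a ⊖ i)) (side-≢half s a⊖i≢h)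

  PathPreimage : Z → Fin 2 → Z → Fin 2 → Z → Set
  PathPreimage i s a s′ b =
    (Low i × s ≡ s′ × Ends (a ⊖ i) (b ⊖ i)) ⊎
    (¬ Low i × s ≢ s′ × Ends (a ⊖ i) (b ⊖ i)) ⊎
    (s ≢ s′ × a ⊖ i ≡ h × b ⊖ i ≡ h)

  0≢half : 0z ≢ h
  0≢half 0≡h = half≢0 (sym 0≡h)

  Ends-≢half : ∀ {c c′} → Ends c c′ → (c ≢ h × c′ ≡ h) ⊎ (c ≡ h × c′ ≢ h)
  Ends-≢half (inj₁ (refl , refl)) = inj₁ (0≢half , refl)
  Ends-≢half (inj₂ (refl , refl)) = inj₂ (refl , 0≢half)

  Ends-side : ∀ i s s′ {c c′} → Ends c c′ → side i c s ≡ side i c′ s′ → (Low i × s ≡ s′) ⊎ (¬ Low i × s ≢ s′)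
  Ends-side i s s′ {c} {c′} ends eq = go (low? i) (Ends-≢half ends)
    where
    open ≡-Reasoning
    go : Dec (Low i) → (c ≢ h × c′ ≡ h) ⊎ (c ≡ h × c′ ≢ h) → (Low i × s ≡ s′) ⊎ (¬ Low i × s ≢ s′)
    go (yes i-low) _ = inj₁ (i-low , trans (sym (side-low c s i-low)) (trans eq (side-low c′ s′ i-low)))
    go (no i-high) (inj₁ (c≢h , c′≡h)) = inj₂ (i-high , λ s≡s′ → opposite≢ s′ (begin
      opposite s′    ≡⟨ side-high-half s′ i-high ⟨
      side i h s′    ≡⟨ cong (λ x → side i x s′) c′≡h ⟨
      side i c′ s′   ≡⟨ eq ⟨
      side i c s     ≡⟨ side-≢half s c≢h ⟩
      s              ≡⟨ s≡s′ ⟩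
      s′             ∎))
    go (no i-high) (inj₂ (c≡h , c′≢h)) = inj₂ (i-high , λ s≡s′ → opposite≢ s (begin
      opposite s     ≡⟨ side-high-half s i-high ⟨
      side i h s     ≡⟨ cong (λ x → side i x s) c≡h ⟨
      side i c s     ≡⟨ eq ⟩
      side i c′ s′   ≡⟨ side-≢half s′ c′≢h ⟩
      s′             ≡⟨ s≡s′ ⟨
      s              ∎))

  OnPath-twist⇒PathPreimage : ∀ i s a s′ b → OnPath (twist i (pt s a)) (twist i (pt s′ b)) → PathPreimage i s a s′ b
  OnPath-twist⇒PathPreimage i s a s′ b (inj₁ (eq , ends)) with Ends-side i s s′ ends eq
  ... | inj₁ (i-low , s≡s′) = inj₁ (i-low , s≡s′ , ends)
  ... | inj₂ (i-high , s≢s′) = inj₂ (inj₁ (i-high , s≢s′ , ends))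
  OnPath-twist⇒PathPreimage i s a s′ b (inj₂ (sides≢ , a⊖i≡h , b⊖i≡h)) =
    inj₂ (inj₂ ((λ s≡s′ → sides≢ (cong₂ (side i) (trans a⊖i≡h (sym b⊖i≡h)) s≡s′)) , a⊖i≡h , b⊖i≡h))

  PathPreimage⇒OnPath-twist : ∀ i s a s′ b → PathPreimage i s a s′ b → OnPath (twist i (pt s a)) (twist i (pt s′ b))
  PathPreimage⇒OnPath-twist i s a s′ b (inj₁ (i-low , s≡s′ , ends)) =
    inj₁ (trans (side-low _ s i-low) (trans s≡s′ (sym (side-low _ s′ i-low))) , ends)
  PathPreimage⇒OnPath-twist i s a s′ b (inj₂ (inj₁ (i-high , s≢s′ , ends@(inj₁ (a⊖i≡0 , b⊖i≡h))))) =
    inj₁ (trans (side-≢half s (λ a⊖i≡h → 0≢half (trans (sym a⊖i≡0) a⊖i≡h)))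
           (trans (sym (≢⇒opposite (λ s′≡s → s≢s′ (sym s′≡s))))
             (sym (trans (cong (λ c → side i c s′) b⊖i≡h) (side-high-half s′ i-high)))) , ends)
  PathPreimage⇒OnPath-twist i s a s′ b (inj₂ (inj₁ (i-high , s≢s′ , ends@(inj₂ (a⊖i≡h , b⊖i≡0))))) =
    inj₁ (trans (trans (cong (λ c → side i c s) a⊖i≡h) (side-high-half s i-high))
           (trans (≢⇒opposite s≢s′) (sym (side-≢half s′ (λ b⊖i≡h → 0≢half (trans (sym b⊖i≡0) b⊖i≡h))))) , ends)
  PathPreimage⇒OnPath-twist i s a s′ b (inj₂ (inj₂ (s≢s′ , a⊖i≡h , b⊖i≡h))) =
    inj₂ ((λ eq → s≢s′ (side-injective i h (subst₂ (λ c c′ → side i c s ≡ side i c′ s′) a⊖i≡h b⊖i≡h eq))) ,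
          a⊖i≡h , b⊖i≡h)

  Ends-translate : ∀ i a b → Ends (a ⊖ i) (b ⊖ i) → (i ≡ a × b ⊖ a ≡ h) ⊎ (i ≡ b × a ⊖ b ≡ h)
  Ends-translate i a b (inj₁ (a⊖i≡0 , b⊖i≡h)) with ⊖≡0⇒≡ a⊖i≡0
  ... | refl = inj₁ (refl , b⊖i≡h)
  Ends-translate i a b (inj₂ (a⊖i≡h , b⊖i≡0)) with ⊖≡0⇒≡ b⊖i≡0
  ... | refl = inj₂ (refl , a⊖i≡h)

  Ends-translate-≢ : ∀ i a b → Ends (a ⊖ i) (b ⊖ i) → a ≢ b
  Ends-translate-≢ i a b (inj₁ (a⊖i≡0 , b⊖i≡h)) refl = 0≢half (trans (sym a⊖i≡0) b⊖i≡h)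
  Ends-translate-≢ i a b (inj₂ (a⊖i≡h , b⊖i≡0)) refl = 0≢half (trans (sym b⊖i≡0) a⊖i≡h)

  Ends-translate-unique : ∀ i j a b → Ends (a ⊖ i) (b ⊖ i) → Ends (a ⊖ j) (b ⊖ j) →
    (Low i → Low j) → (Low j → Low i) → i ≡ j
  Ends-translate-unique i j a b ends ends′ i→j j→i with Ends-translate i a b ends | Ends-translate j a b ends′
  ... | inj₁ (refl , _) | inj₁ (refl , _) = refl
  ... | inj₂ (refl , _) | inj₂ (refl , _) = refl
  ... | inj₁ (refl , j⊖i≡h) | inj₂ (refl , _) with low-xor-⊖≡half i j j⊖i≡h
  ...   | inj₁ (i-low , j-high) = ⊥-elim (j-high (i→j i-low))
  ...   | inj₂ (i-high , j-low) = ⊥-elim (i-high (j→i j-low))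
  Ends-translate-unique i j a b ends ends′ i→j j→i | inj₂ (refl , _) | inj₁ (refl , i⊖j≡h) with low-xor-⊖≡half j i i⊖j≡h
  ...   | inj₁ (j-low , i-high) = ⊥-elim (i-high (j→i j-low))
  ...   | inj₂ (j-high , i-low) = ⊥-elim (j-high (i→j i-low))

  PathPreimage-unique : ∀ i j s a s′ b → PathPreimage i s a s′ b → PathPreimage j s a s′ b → i ≡ j
  PathPreimage-unique i j s a s′ b (inj₁ (i-low , _ , e)) (inj₁ (j-low , _ , e′)) =
    Ends-translate-unique i j a b e e′ (λ _ → j-low) (λ _ → i-low)
  PathPreimage-unique i j s a s′ b (inj₂ (inj₁ (i-high , _ , e))) (inj₂ (inj₁ (j-high , _ , e′))) =
    Ends-translate-unique i j a b e e′ (λ i-low → ⊥-elim (i-high i-low)) (λ j-low → ⊥-elim (j-high j-low))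
  PathPreimage-unique i j s a s′ b (inj₁ (_ , s≡s′ , _)) (inj₂ (inj₁ (_ , s≢s′ , _))) = ⊥-elim (s≢s′ s≡s′)
  PathPreimage-unique i j s a s′ b (inj₂ (inj₁ (_ , s≢s′ , _))) (inj₁ (_ , s≡s′ , _)) = ⊥-elim (s≢s′ s≡s′)
  PathPreimage-unique i j s a s′ b (inj₂ (inj₂ (_ , a⊖i≡h , _))) (inj₂ (inj₂ (_ , a⊖j≡h , _))) =
    ⊖-cancelˡ a (trans a⊖i≡h (sym a⊖j≡h))
  PathPreimage-unique i j s a s′ b (inj₂ (inj₂ (_ , a⊖i≡h , b⊖i≡h))) (inj₁ (_ , _ , e)) =
    ⊥-elim (Ends-translate-≢ j a b e (⊖-cancelʳ i (trans a⊖i≡h (sym b⊖i≡h))))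
  PathPreimage-unique i j s a s′ b (inj₂ (inj₂ (_ , a⊖i≡h , b⊖i≡h))) (inj₂ (inj₁ (_ , _ , e))) =
    ⊥-elim (Ends-translate-≢ j a b e (⊖-cancelʳ i (trans a⊖i≡h (sym b⊖i≡h))))
  PathPreimage-unique i j s a s′ b (inj₁ (_ , _ , e)) (inj₂ (inj₂ (_ , a⊖j≡h , b⊖j≡h))) =
    ⊥-elim (Ends-translate-≢ i a b e (⊖-cancelʳ j (trans a⊖j≡h (sym b⊖j≡h))))
  PathPreimage-unique i j s a s′ b (inj₂ (inj₁ (_ , _ , e))) (inj₂ (inj₂ (_ , a⊖j≡h , b⊖j≡h))) =
    ⊥-elim (Ends-translate-≢ i a b e (⊖-cancelʳ j (trans a⊖j≡h (sym b⊖j≡h))))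

  Ends-translate-difference : ∀ i a b → Ends (a ⊖ i) (b ⊖ i) → a ⊖ b ≡ h × b ⊖ a ≡ h
  Ends-translate-difference i a b e with Ends-translate i a b e
  ... | inj₁ (_ , b⊖a≡h) = ⊖≡half-sym b a b⊖a≡h , b⊖a≡h
  ... | inj₂ (_ , a⊖b≡h) = a⊖b≡h , ⊖≡half-sym a b a⊖b≡h

  PathPreimage-difference : ∀ i s a s′ b → PathPreimage i s a s′ b → (a ⊖ b ≡ h × b ⊖ a ≡ h) ⊎ (a ≡ b × s ≢ s′)
  PathPreimage-difference i s a s′ b (inj₁ (_ , _ , e)) = inj₁ (Ends-translate-difference i a b e)
  PathPreimage-difference i s a s′ b (inj₂ (inj₁ (_ , _ , e))) = inj₁ (Ends-translate-difference i a b e)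
  PathPreimage-difference i s a s′ b (inj₂ (inj₂ (s≢s′ , a⊖i≡h , b⊖i≡h))) =
    inj₂ (⊖-cancelʳ i (trans a⊖i≡h (sym b⊖i≡h)) , s≢s′)

  PathPreimage-level : ∀ s a b → a ⊖ b ≡ h → ∃ λ i → PathPreimage i s a s b
  PathPreimage-level s a b a⊖b≡h with low-xor-⊖≡half a b (⊖≡half-sym a b a⊖b≡h)
  ... | inj₁ (a-low , _) = a , inj₁ (a-low , refl , inj₁ (⊖-self a , ⊖≡half-sym a b a⊖b≡h))
  ... | inj₂ (_ , b-low) = b , inj₁ (b-low , refl , inj₂ (a⊖b≡h , ⊖-self b))

  PathPreimage-cross : ∀ s s′ a b → s ≢ s′ → a ⊖ b ≡ h → ∃ λ i → PathPreimage i s a s′ b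
  PathPreimage-cross s s′ a b s≢s′ a⊖b≡h with low-xor-⊖≡half a b (⊖≡half-sym a b a⊖b≡h)
  ... | inj₂ (a-high , _) = a , inj₂ (inj₁ (a-high , s≢s′ , inj₁ (⊖-self a , ⊖≡half-sym a b a⊖b≡h)))
  ... | inj₁ (_ , b-high) = b , inj₂ (inj₁ (b-high , s≢s′ , inj₂ (a⊖b≡h , ⊖-self b)))

  PathPreimage-vertical : ∀ s s′ a → s ≢ s′ → ∃ λ i → PathPreimage i s a s′ a
  PathPreimage-vertical s s′ a s≢s′ = a ⊖ h , inj₂ (inj₂ (s≢s′ , ⊖-⊖-cancel a h , ⊖-⊖-cancel a h))

-- Factorisations of K_{2n+1}

module BaseFactor (m : ℕ) (F : Graph (Vtx (suc m))) (F-simple : IsSimple F) (F-deg : MaxDegree2 F)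
                  (x₀ x₁ : Fin (suc m)) (∞x₀ : F ∞ (pt 𝟘 x₀)) (∞x₁ : F ∞ (pt 𝟙 x₁)) where
  open Cyclic m
  open Translation m

  F-sym : ∀ {u w} → F u w → F w u
  F-sym = IsSimple.sym F-simple

  F-irrefl : ∀ {u} → ¬ F u u
  F-irrefl = IsSimple.irrefl F-simple

  ∞x₀-unique : ∀ {a} → F ∞ (pt 𝟘 a) → a ≡ x₀
  ∞x₀-unique e with third-neighbour {G = F} F-deg ∞x₀ ∞x₁ (λ ()) e
  ... | inj₁ eq = pt-injectiveʳ eq
  ... | inj₂ ()

  ∞x₁-unique : ∀ {a} → F ∞ (pt 𝟙 a) → a ≡ x₁
  ∞x₁-unique e with third-neighbour {G = F} F-deg ∞x₀ ∞x₁ (λ ()) e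
  ... | inj₁ ()
  ... | inj₂ eq = pt-injectiveʳ eq

  record CyclicFactorisation : Set where
    field
      ψ            : Z → Vtx N ↔ Vtx N
      ψ-∞          : ∀ i → Inverse.to (ψ i) ∞ ≡ ∞
      cover        : ∀ u w → u ≢ w → ∃ λ i → (F on Inverse.to (ψ i)) u w
      disjoint     : ∀ i j u w → (F on Inverse.to (ψ i)) u w → (F on Inverse.to (ψ j)) u w → i ≡ j
      ends-cover   : ∀ x y → F (pt 𝟘 x) (pt 𝟙 y) → ∀ u → u ≢ ∞ → ∃ λ i → IsEndOf x y (Inverse.to (ψ i) u)
      ends-unique  : ∀ x y → F (pt 𝟘 x) (pt 𝟙 y) → ∀ u i j →
                     IsEndOf x y (Inverse.to (ψ i) u) → IsEndOf x y (Inverse.to (ψ j) u) → i ≡ j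

  ≢0? : ∀ (d : Z) → Dec (toℕ d ≢ 0)
  ≢0? d = ¬? (toℕ d ℕ.≟ 0)

  odd-factorisation : ΔIs N F 𝟘 𝟘 (λ d → toℕ d ≢ 0) → ΔIs N F 𝟙 𝟙 (λ d → toℕ d ≢ 0) →
                      ΔIs N F 𝟘 𝟙 (λ _ → ⊤) →
                      CyclicFactorisation
  odd-factorisation Δ₀₀ Δ₁₁ Δ₀₁ = record
    { ψ = translate-↔
    ; ψ-∞ = λ _ → refl
    ; cover = λ u w u≢w → translate-cover u w u≢w (distinct-admissible u w u≢w)
    ; disjoint = λ i j u w → translate-unique u w i j
    ; ends-cover = λ x y _ → translate-IsEndOf x y
    ; ends-unique = λ x y _ → translate-IsEndOf-unique x y
    }
    where
    open DifferenceMethod F F-sym F-irrefl x₀ x₁ ∞x₀ ∞x₁ ∞x₀-unique ∞x₁-unique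
      (λ d → toℕ d ≢ 0) (λ d → toℕ d ≢ 0) (λ _ → ⊤) ≢0? ≢0? (λ _ → yes tt) Δ₀₀ Δ₁₁ Δ₀₁
    distinct-admissible : ∀ u w → u ≢ w → Admissible u w
    distinct-admissible ∞ _ _ = tt
    distinct-admissible (pt _ _) ∞ _ = tt
    distinct-admissible (pt fzero a) (pt fzero b) u≢w a⊖b≡0 = u≢w (cong (pt 𝟘) (toℕ-⊖≡0⇒≡ a⊖b≡0))
    distinct-admissible (pt fzero a) (pt (fsuc fzero) b) _ = tt
    distinct-admissible (pt (fsuc fzero) a) (pt fzero b) _ = tt
    distinct-admissible (pt (fsuc fzero) a) (pt (fsuc fzero) b) u≢w a⊖b≡0 = u≢w (cong (pt 𝟙) (toℕ-⊖≡0⇒≡ a⊖b≡0))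

  CyclicFactorisation⇒PermutationSolution : ∀ {L} → F ≅ Cyc L → CyclicFactorisation → PermutationSolution L (Vtx N)
  CyclicFactorisation⇒PermutationSolution {L} F≅L factorisation = record
    { base = F
    ; baseSimple = F-simple
    ; baseIso = F≅L
    ; k = N
    ; ψ = ψ
    ; removed = λ _ _ → ⊥
    ; removedOK = (λ _ _ _ ()) , (λ 2∣L → ⊥-elim (2∤1+n+n (suc m) (subst (2 ∣_) order-L 2∣L)))
    ; cover = λ u w u≢w _ → cover u w u≢w
    ; avoid = λ _ _ _ _ ()
    ; disjoint = disjoint
    }
    where
    open CyclicFactorisation factorisation
    order-L : sum L ≡ suc (N + N)
    order-L = order-≅ {L = L} (Vtx↔Fin N) F≅L

module EvenFactor (m : ℕ) (F : Graph (Vtx (suc m))) (F-simple : IsSimple F) (F-deg : MaxDegree2 F)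
  (x₀ x₁ : Fin (suc m)) (∞x₀ : F ∞ (pt 𝟘 x₀)) (∞x₁ : F ∞ (pt 𝟙 x₁))
  (h : Fin (suc m)) (h+h≡N : toℕ h + toℕ h ≡ suc m)
  (P₁ : F (pt 𝟘 fzero) (pt 𝟘 h)) (P₂ : F (pt 𝟘 h) (pt 𝟙 h)) (P₃ : F (pt 𝟙 h) (pt 𝟙 fzero))
  (Δ₀₀ : ΔIs (suc m) (F minusP (fzero , h)) 𝟘 𝟘 (λ d → toℕ d ≢ 0 × d ≢ h))
  (Δ₀₁ : ΔIs (suc m) (F minusP (fzero , h)) 𝟘 𝟙 (λ d → toℕ d ≢ 0 × d ≢ h))
  (Δ₁₁ : ΔIs (suc m) (F minusP (fzero , h)) 𝟙 𝟙 (λ d → toℕ d ≢ 0 × d ≢ h)) where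

  open Cyclic m
  open Half h h+h≡N
  open Translation m
  open TwistedPath m h h+h≡N
  open BaseFactor m F F-simple F-deg x₀ x₁ ∞x₀ ∞x₁

  P : Vtx N → Vtx N → Set
  P = PEdge N 0z h

  B : Graph (Vtx N)
  B = F minusP (0z , h)

  B-sym : ∀ {u w} → B u w → B w u
  B-sym (e , ¬P) = F-sym e , λ p → ¬P (PEdge-sym p)

  B-irrefl : ∀ {u} → ¬ B u u
  B-irrefl (e , _) = F-irrefl e

  P⇒F : ∀ {u w} → P u w → F u w
  P⇒F (inj₁ (refl , refl)) = P₁
  P⇒F (inj₂ (inj₁ (refl , refl))) = F-sym P₁
  P⇒F (inj₂ (inj₂ (inj₁ (refl , refl)))) = P₂
  P⇒F (inj₂ (inj₂ (inj₂ (inj₁ (refl , refl))))) = F-sym P₂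
  P⇒F (inj₂ (inj₂ (inj₂ (inj₂ (inj₁ (refl , refl)))))) = P₃
  P⇒F (inj₂ (inj₂ (inj₂ (inj₂ (inj₂ (refl , refl)))))) = F-sym P₃

  F⇒B⊎P : ∀ {u w} → F u w → B u w ⊎ P u w
  F⇒B⊎P {u} {w} e with PEdge? u w
  ... | yes p = inj₂ p
  ... | no ¬p = inj₁ (e , ¬p)

  -- (0,h) and (1,h) are interior vertices of P, so both their F-edges lie on P.
  B-avoids-half : ∀ s w → ¬ B (pt s h) w
  B-avoids-half fzero w (e , ¬P) with third-neighbour {G = F} F-deg (F-sym P₁) P₂ (λ ()) e
  ... | inj₁ refl = ¬P (inj₂ (inj₁ (refl , refl)))
  ... | inj₂ refl = ¬P (inj₂ (inj₂ (inj₁ (refl , refl))))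
  B-avoids-half (fsuc fzero) w (e , ¬P) with third-neighbour {G = F} F-deg (F-sym P₂) P₃ (λ ()) e
  ... | inj₁ refl = ¬P (inj₂ (inj₂ (inj₂ (inj₁ (refl , refl)))))
  ... | inj₂ refl = ¬P (inj₂ (inj₂ (inj₂ (inj₂ (inj₁ (refl , refl))))))

  B-≢half : ∀ {s c w} → B (pt s c) w → c ≢ h
  B-≢half {s} {w = w} e refl = B-avoids-half s w e

  twist-B : ∀ i u {v} → B (twist i u) v → twist i u ≡ translate i u
  twist-B i ∞ _ = refl
  twist-B i (pt s a) e = twist-≢half i s a (B-≢half e)

  translate-B : ∀ i u {v} → B (translate i u) v → twist i u ≡ translate i u
  translate-B i ∞ _ = refl
  translate-B i (pt s a) e = twist-≢half i s a (B-≢half e)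

  F-twist⇒ : ∀ i u w → F (twist i u) (twist i w) → B (translate i u) (translate i w) ⊎ P (twist i u) (twist i w)
  F-twist⇒ i u w e with F⇒B⊎P e
  ... | inj₂ p = inj₂ p
  ... | inj₁ b = inj₁ (subst₂ B (twist-B i u b) (twist-B i w (B-sym b)) b)

  B-translate⇒F-twist : ∀ i u w → B (translate i u) (translate i w) → F (twist i u) (twist i w)
  B-translate⇒F-twist i u w b = proj₁ (subst₂ B (sym (translate-B i u b)) (sym (translate-B i w (B-sym b))) b)

  PathPreimage⇒F-twist : ∀ i s a s′ b → PathPreimage i s a s′ b → F (twist i (pt s a)) (twist i (pt s′ b))
  PathPreimage⇒F-twist i s a s′ b pre = P⇒F (OnPath⇒PEdge _ _ (PathPreimage⇒OnPath-twist i s a s′ b pre))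

  S : Z → Set
  S d = toℕ d ≢ 0 × d ≢ h

  S? : ∀ d → Dec (S d)
  S? d = ¬? (toℕ d ℕ.≟ 0) ×-dec ¬? (d ≟ h)

  ¬S⇒ : ∀ d → ¬ S d → (d ≡ h) ⊎ (toℕ d ≡ 0)
  ¬S⇒ d ¬Sd with d ≟ h | toℕ d ℕ.≟ 0
  ... | yes d≡h | _ = inj₁ d≡h
  ... | no _ | yes d≡0 = inj₂ d≡0
  ... | no d≢h | no d≢0 = ⊥-elim (¬Sd (d≢0 , d≢h))

  open DifferenceMethod B B-sym B-irrefl x₀ x₁ (∞x₀ , PEdge⇒OnPath) (∞x₁ , PEdge⇒OnPath)
    (λ e → ∞x₀-unique (proj₁ e)) (λ e → ∞x₁-unique (proj₁ e)) S S S S? S? S? Δ₀₀ Δ₁₁ Δ₀₁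

  inadmissible-cover : ∀ u w → u ≢ w → ¬ Admissible u w → ∃ λ i → F (twist i u) (twist i w)
  inadmissible-cover ∞ _ _ ¬adm = ⊥-elim (¬adm tt)
  inadmissible-cover (pt _ _) ∞ _ ¬adm = ⊥-elim (¬adm tt)
  inadmissible-cover (pt fzero a) (pt fzero b) u≢w ¬adm with ¬S⇒ (a ⊖ b) ¬adm
  ... | inj₁ a⊖b≡h = let i , pre = PathPreimage-level 𝟘 a b a⊖b≡h in i , PathPreimage⇒F-twist i 𝟘 a 𝟘 b pre
  ... | inj₂ a⊖b≡0 = ⊥-elim (u≢w (cong (pt 𝟘) (toℕ-⊖≡0⇒≡ a⊖b≡0)))
  inadmissible-cover (pt (fsuc fzero) a) (pt (fsuc fzero) b) u≢w ¬adm with ¬S⇒ (a ⊖ b) ¬adm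
  ... | inj₁ a⊖b≡h = let i , pre = PathPreimage-level 𝟙 a b a⊖b≡h in i , PathPreimage⇒F-twist i 𝟙 a 𝟙 b pre
  ... | inj₂ a⊖b≡0 = ⊥-elim (u≢w (cong (pt 𝟙) (toℕ-⊖≡0⇒≡ a⊖b≡0)))
  inadmissible-cover (pt fzero a) (pt (fsuc fzero) b) _ ¬adm with ¬S⇒ (a ⊖ b) ¬adm
  ... | inj₁ a⊖b≡h = let i , pre = PathPreimage-cross 𝟘 𝟙 a b (λ ()) a⊖b≡h in i , PathPreimage⇒F-twist i 𝟘 a 𝟙 b pre
  ... | inj₂ a⊖b≡0 with toℕ-⊖≡0⇒≡ a⊖b≡0
  ...   | refl = let i , pre = PathPreimage-vertical 𝟘 𝟙 a (λ ()) in i , PathPreimage⇒F-twist i 𝟘 a 𝟙 a pre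
  inadmissible-cover (pt (fsuc fzero) a) (pt fzero b) _ ¬adm with ¬S⇒ (b ⊖ a) ¬adm
  ... | inj₁ b⊖a≡h = let i , pre = PathPreimage-cross 𝟙 𝟘 a b (λ ()) (⊖≡half-sym b a b⊖a≡h) in i , PathPreimage⇒F-twist i 𝟙 a 𝟘 b pre
  ... | inj₂ b⊖a≡0 with toℕ-⊖≡0⇒≡ b⊖a≡0
  ...   | refl = let i , pre = PathPreimage-vertical 𝟙 𝟘 b (λ ()) in i , PathPreimage⇒F-twist i 𝟙 b 𝟘 b pre

  PathPreimage⇒¬Admissible : ∀ i s a s′ b → PathPreimage i s a s′ b → ¬ Admissible (pt s a) (pt s′ b)
  PathPreimage⇒¬Admissible i s a s′ b pre adm = go s s′ (PathPreimage-difference i s a s′ b pre) adm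
    where
    go : ∀ s s′ → (a ⊖ b ≡ h × b ⊖ a ≡ h) ⊎ (a ≡ b × s ≢ s′) → ¬ Admissible (pt s a) (pt s′ b)
    go fzero fzero (inj₁ (a⊖b≡h , _)) (_ , a⊖b≢h) = a⊖b≢h a⊖b≡h
    go fzero (fsuc fzero) (inj₁ (a⊖b≡h , _)) (_ , a⊖b≢h) = a⊖b≢h a⊖b≡h
    go (fsuc fzero) fzero (inj₁ (_ , b⊖a≡h)) (_ , b⊖a≢h) = b⊖a≢h b⊖a≡h
    go (fsuc fzero) (fsuc fzero) (inj₁ (a⊖b≡h , _)) (_ , a⊖b≢h) = a⊖b≢h a⊖b≡h
    go fzero fzero (inj₂ (_ , s≢s)) _ = s≢s refl
    go (fsuc fzero) (fsuc fzero) (inj₂ (_ , s≢s)) _ = s≢s refl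
    go fzero (fsuc fzero) (inj₂ (refl , _)) (a⊖a≢0 , _) = a⊖a≢0 (cong toℕ (⊖-self a))
    go (fsuc fzero) fzero (inj₂ (refl , _)) (a⊖a≢0 , _) = a⊖a≢0 (cong toℕ (⊖-self a))

  twist-cover : ∀ u w → u ≢ w → ∃ λ i → F (twist i u) (twist i w)
  twist-cover u w u≢w with Admissible? u w
  ... | yes adm = let i , b = translate-cover u w u≢w adm in i , B-translate⇒F-twist i u w b
  ... | no ¬adm = inadmissible-cover u w u≢w ¬adm

  P-twist⇒PathPreimage : ∀ k s a s′ b → P (twist k (pt s a)) (twist k (pt s′ b)) → PathPreimage k s a s′ b
  P-twist⇒PathPreimage k s a s′ b p = OnPath-twist⇒PathPreimage k s a s′ b (PEdge⇒OnPath p)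

  P-twist⇒¬Admissible : ∀ k u w → P (twist k u) (twist k w) → ¬ Admissible u w
  P-twist⇒¬Admissible k ∞ _ p = ⊥-elim (PEdge⇒OnPath p)
  P-twist⇒¬Admissible k (pt _ _) ∞ p = ⊥-elim (PEdge⇒OnPath p)
  P-twist⇒¬Admissible k (pt s a) (pt s′ b) p = PathPreimage⇒¬Admissible k s a s′ b (P-twist⇒PathPreimage k s a s′ b p)

  P-twist-unique : ∀ i j u w → P (twist i u) (twist i w) → P (twist j u) (twist j w) → i ≡ j
  P-twist-unique i j ∞ _ p _ = ⊥-elim (PEdge⇒OnPath p)
  P-twist-unique i j (pt _ _) ∞ p _ = ⊥-elim (PEdge⇒OnPath p)
  P-twist-unique i j (pt s a) (pt s′ b) p p′ =
    PathPreimage-unique i j s a s′ b (P-twist⇒PathPreimage i s a s′ b p) (P-twist⇒PathPreimage j s a s′ b p′)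

  twist-disjoint : ∀ i j u w → F (twist i u) (twist i w) → F (twist j u) (twist j w) → i ≡ j
  twist-disjoint i j u w e e′ with F-twist⇒ i u w e | F-twist⇒ j u w e′
  ... | inj₁ b | inj₁ b′ = translate-unique u w i j b b′
  ... | inj₁ b | inj₂ p′ = ⊥-elim (P-twist⇒¬Admissible j u w p′ (translate-admissible u w i b))
  ... | inj₂ p | inj₁ b′ = ⊥-elim (P-twist⇒¬Admissible i u w p (translate-admissible u w j b′))
  ... | inj₂ p | inj₂ p′ = P-twist-unique i j u w p p′

  end-at-half : ∀ x y → F (pt 𝟘 x) (pt 𝟙 y) → ∀ t → IsEndOf x y (pt t h) → x ≡ h × y ≡ h
  end-at-half x y xy t (inj₁ eq) with pt-injectiveʳ eq
  ... | refl with third-neighbour {G = F} F-deg (F-sym P₁) P₂ (λ ()) xy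
  ...   | inj₁ ()
  ...   | inj₂ eq′ = refl , pt-injectiveʳ eq′
  end-at-half x y xy t (inj₂ eq) with pt-injectiveʳ eq
  ... | refl with third-neighbour {G = F} F-deg (F-sym P₂) P₃ (λ ()) (F-sym xy)
  ...   | inj₁ eq′ = pt-injectiveʳ eq′ , refl
  ...   | inj₂ ()

  end-at-half-any-level : ∀ x y → F (pt 𝟘 x) (pt 𝟙 y) → ∀ t t′ → IsEndOf x y (pt t h) → IsEndOf x y (pt t′ h)
  end-at-half-any-level x y xy t fzero end = inj₁ (cong (pt 𝟘) (sym (proj₁ (end-at-half x y xy t end))))
  end-at-half-any-level x y xy t (fsuc fzero) end = inj₂ (cong (pt 𝟙) (sym (proj₂ (end-at-half x y xy t end))))

  twist-IsEndOf⇒translate : ∀ x y → F (pt 𝟘 x) (pt 𝟙 y) → ∀ i u → IsEndOf x y (twist i u) → IsEndOf x y (translate i u)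
  twist-IsEndOf⇒translate x y xy i ∞ end = end
  twist-IsEndOf⇒translate x y xy i (pt s a) end = go (a ⊖ i ≟ h)
    where
    go : Dec (a ⊖ i ≡ h) → IsEndOf x y (translate i (pt s a))
    go (no a⊖i≢h) = subst (IsEndOf x y) (twist-≢half i s a a⊖i≢h) end
    go (yes a⊖i≡h) = subst (λ c → IsEndOf x y (pt s c)) (sym a⊖i≡h)
      (end-at-half-any-level x y xy _ s (subst (λ c → IsEndOf x y (pt (side i (a ⊖ i) s) c)) a⊖i≡h end))

  translate-IsEndOf⇒twist : ∀ x y → F (pt 𝟘 x) (pt 𝟙 y) → ∀ i u → IsEndOf x y (translate i u) → IsEndOf x y (twist i u)
  translate-IsEndOf⇒twist x y xy i ∞ end = end
  translate-IsEndOf⇒twist x y xy i (pt s a) end = go (a ⊖ i ≟ h)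
    where
    go : Dec (a ⊖ i ≡ h) → IsEndOf x y (twist i (pt s a))
    go (no a⊖i≢h) = subst (IsEndOf x y) (sym (twist-≢half i s a a⊖i≢h)) end
    go (yes a⊖i≡h) = subst (λ c → IsEndOf x y (pt (side i (a ⊖ i) s) c)) (sym a⊖i≡h)
      (end-at-half-any-level x y xy s _ (subst (λ c → IsEndOf x y (pt s c)) a⊖i≡h end))

  even-factorisation : CyclicFactorisation
  even-factorisation = record
    { ψ = twist-↔
    ; ψ-∞ = λ _ → refl
    ; cover = twist-cover
    ; disjoint = twist-disjoint
    ; ends-cover = λ x y xy u u≢∞ → let i , end = translate-IsEndOf x y u u≢∞ in
                     i , translate-IsEndOf⇒twist x y xy i u end
    ; ends-unique = λ x y xy u i j end end′ → translate-IsEndOf-unique x y u i j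
                     (twist-IsEndOf⇒translate x y xy i u end) (twist-IsEndOf⇒translate x y xy j u end′)
    }

-- Subdividing an edge of an ℓ₁-cycle

CycAdjℕ-cong : ∀ {k k′ a a′ b b′} → k ≡ k′ → a ≡ a′ → b ≡ b′ → CycAdjℕ k a b → CycAdjℕ k′ a′ b′
CycAdjℕ-cong refl refl refl adj = adj

CycAdjℕ-sym : ∀ {ℓ a b} → CycAdjℕ ℓ a b → CycAdjℕ ℓ b a
CycAdjℕ-sym (inj₁ e) = inj₂ (inj₁ e)
CycAdjℕ-sym (inj₂ (inj₁ e)) = inj₁ e
CycAdjℕ-sym (inj₂ (inj₂ (inj₁ e))) = inj₂ (inj₂ (inj₂ e))
CycAdjℕ-sym (inj₂ (inj₂ (inj₂ e))) = inj₂ (inj₂ (inj₁ e))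

module CycleArithmetic (q : ℕ) where
  open Cyclic (suc (suc q)) public

  ℓ : ℕ
  ℓ = N

  one : Z
  one = fsuc fzero

  last : Z
  last = fromℕ (suc (suc q))

  toℕ-⊕one : ∀ a → (suc (toℕ a) < ℓ × toℕ (a ⊕ one) ≡ suc (toℕ a)) ⊎ (suc (toℕ a) ≡ ℓ × toℕ (a ⊕ one) ≡ 0)
  toℕ-⊕one a with suc (toℕ a) ℕ.<? ℓ
  ... | yes a+1<ℓ = inj₁ (a+1<ℓ , trans (toℕ-⊕ a one) (trans (cong (_% ℓ) (ℕ.+-comm (toℕ a) 1)) (m<n⇒m%n≡m a+1<ℓ)))
  ... | no a+1≮ℓ = inj₂ (a+1≡ℓ , trans (toℕ-⊕ a one) (trans (cong (_% ℓ) (trans (ℕ.+-comm (toℕ a) 1) a+1≡ℓ)) (n%n≡0 ℓ)))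
    where
    a+1≡ℓ : suc (toℕ a) ≡ ℓ
    a+1≡ℓ = ℕ.≤-antisym (toℕ<n a) (ℕ.≮⇒≥ a+1≮ℓ)

  next-adjacent : ∀ a → CycAdjFin ℓ a (a ⊕ one)
  next-adjacent a with toℕ-⊕one a
  ... | inj₁ (_ , eq) = inj₁ eq
  ... | inj₂ (a+1≡ℓ , eq) = inj₂ (inj₂ (inj₁ (a+1≡ℓ , eq)))

  CycAdj⇒⊕one : ∀ a b → CycAdjFin ℓ a b → (b ≡ a ⊕ one) ⊎ (a ≡ b ⊕ one)
  CycAdj⇒⊕one a b (inj₁ b≡a+1) with toℕ-⊕one a
  ... | inj₁ (_ , eq) = inj₁ (toℕ-injective (trans b≡a+1 (sym eq)))
  ... | inj₂ (a+1≡ℓ , _) = ⊥-elim (ℕ.<-irrefl (trans b≡a+1 a+1≡ℓ) (toℕ<n b))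
  CycAdj⇒⊕one a b (inj₂ (inj₁ a≡b+1)) with toℕ-⊕one b
  ... | inj₁ (_ , eq) = inj₂ (toℕ-injective (trans a≡b+1 (sym eq)))
  ... | inj₂ (b+1≡ℓ , _) = ⊥-elim (ℕ.<-irrefl (trans a≡b+1 b+1≡ℓ) (toℕ<n a))
  CycAdj⇒⊕one a b (inj₂ (inj₂ (inj₁ (a+1≡ℓ , b≡0)))) with toℕ-⊕one a
  ... | inj₁ (a+1<ℓ , _) = ⊥-elim (ℕ.<-irrefl a+1≡ℓ a+1<ℓ)
  ... | inj₂ (_ , eq) = inj₁ (toℕ-injective (trans b≡0 (sym eq)))
  CycAdj⇒⊕one a b (inj₂ (inj₂ (inj₂ (b+1≡ℓ , a≡0)))) with toℕ-⊕one b
  ... | inj₁ (b+1<ℓ , _) = ⊥-elim (ℕ.<-irrefl b+1≡ℓ b+1<ℓ)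
  ... | inj₂ (_ , eq) = inj₂ (toℕ-injective (trans a≡0 (sym eq)))

  ⊕one⇒CycAdj : ∀ a b → (b ≡ a ⊕ one) ⊎ (a ≡ b ⊕ one) → CycAdjFin ℓ a b
  ⊕one⇒CycAdj a _ (inj₁ refl) = next-adjacent a
  ⊕one⇒CycAdj _ b (inj₂ refl) = CycAdjℕ-sym (next-adjacent b)

  previous-adjacent : ∀ a → CycAdjFin ℓ a (a ⊖ one)
  previous-adjacent a = ⊕one⇒CycAdj a (a ⊖ one) (inj₂ (sym (⊖-⊕-cancel a one)))

  -- This is where ℓ ≥ 3 is used: one ⊕ one ≢ 0.
  next≢previous : ∀ a → a ⊕ one ≢ a ⊖ one
  next≢previous a eq = ℕ.1+n≢0 (begin
    2                  ≡⟨ m<n⇒m%n≡m {n = ℓ} {m = 2} (s≤s (s≤s (s≤s z≤n))) ⟨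
    (1 + 1) % ℓ        ≡⟨ toℕ-⊕ one one ⟨
    toℕ (one ⊕ one)    ≡⟨ cong (λ x → toℕ (one ⊕ x)) (∙-cancelˡ a one (⊝ one) eq) ⟩
    toℕ (one ⊖ one)    ≡⟨ cong toℕ (⊖-self one) ⟩
    0                  ∎)
    where open ≡-Reasoning

  last⊕one : last ⊕ one ≡ 0z
  last⊕one with toℕ-⊕one last
  ... | inj₁ (last+1<ℓ , _) = ⊥-elim (ℕ.<-irrefl (cong suc (toℕ-fromℕ (suc (suc q)))) last+1<ℓ)
  ... | inj₂ (_ , eq) = toℕ-injective eq

  last⊕-⊕one : ∀ a → last ⊕ (a ⊕ one) ≡ a
  last⊕-⊕one a = begin
    last ⊕ (a ⊕ one)   ≡⟨ cong (last ⊕_) (⊕-comm a one) ⟩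
    last ⊕ (one ⊕ a)   ≡⟨ ⊕-assoc last one a ⟨
    last ⊕ one ⊕ a     ≡⟨ cong (_⊕ a) last⊕one ⟩
    0z ⊕ a             ≡⟨ ⊕-identityˡ a ⟩
    a                  ∎
    where open ≡-Reasoning

  rotate : ∀ {V : Set} {G : Graph V} → CycleIn G ℓ → Z → CycleIn G ℓ
  rotate C s = record
    { c = λ a → CycleIn.c C (a ⊕ s)
    ; inj = λ a b eq → ∙-cancelʳ s a b (CycleIn.inj C _ _ eq)
    ; edges = λ a b ab → CycleIn.edges C _ _ (⊕one⇒CycAdj (a ⊕ s) (b ⊕ s) (shift (CycAdj⇒⊕one a b ab)))
    }
    where
    ⊕one-⊕ : ∀ a → a ⊕ one ⊕ s ≡ a ⊕ s ⊕ one
    ⊕one-⊕ a = trans (⊕-assoc a one s) (trans (cong (a ⊕_) (⊕-comm one s)) (sym (⊕-assoc a s one)))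
    shift : ∀ {a b} → (b ≡ a ⊕ one) ⊎ (a ≡ b ⊕ one) → (b ⊕ s ≡ a ⊕ s ⊕ one) ⊎ (a ⊕ s ≡ b ⊕ s ⊕ one)
    shift {a} (inj₁ refl) = inj₁ (⊕one-⊕ a)
    shift {b = b} (inj₂ refl) = inj₂ (⊕one-⊕ b)

  rotate-to-edge : ∀ {V : Set} {G : Graph V} (C : CycleIn G ℓ) a b → CycAdjFin ℓ a b →
    Σ (CycleIn G ℓ) λ C′ → ((CycleIn.c C′ last ≡ CycleIn.c C a) × (CycleIn.c C′ 0z ≡ CycleIn.c C b)) ⊎
                            ((CycleIn.c C′ last ≡ CycleIn.c C b) × (CycleIn.c C′ 0z ≡ CycleIn.c C a))
  rotate-to-edge C a b ab with CycAdj⇒⊕one a b ab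
  ... | inj₁ refl = rotate C (a ⊕ one) , inj₁ (cong (CycleIn.c C) (last⊕-⊕one a) , cong (CycleIn.c C) (⊕-identityˡ (a ⊕ one)))
  ... | inj₂ refl = rotate C (b ⊕ one) , inj₂ (cong (CycleIn.c C) (last⊕-⊕one b) , cong (CycleIn.c C) (⊕-identityˡ (b ⊕ one)))

module CycleNormalisation (q : ℕ) (rest : List ℕ) where
  open CycleArithmetic q

  L : List ℕ
  L = ℓ ∷ rest

  H : Graph (CycVtx L)
  H = Cyc L

  component : CycVtx L → ℕ
  component x = toℕ (proj₁ x)

  position : CycVtx L → ℕ
  position x = toℕ (proj₂ x)

  module OfCycle (g : Fin ℓ → CycVtx L) (g-injective : ∀ a b → g a ≡ g b → a ≡ b)
                 (g-adjacent : ∀ a b → CycAdjFin ℓ a b → H (g a) (g b)) where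

    g-neighbour : ∀ a {y} → H (g a) y → (y ≡ g (a ⊕ one)) ⊎ (y ≡ g (a ⊖ one))
    g-neighbour a e = third-neighbour {G = H} (Cyc-maxDegree2 L)
      (g-adjacent a (a ⊕ one) (next-adjacent a)) (g-adjacent a (a ⊖ one) (previous-adjacent a))
      (λ eq → next≢previous a (g-injective _ _ eq)) e

    g-reflects : ∀ a b → H (g a) (g b) → CycAdjFin ℓ a b
    g-reflects a b e with g-neighbour a e
    ... | inj₁ eq = subst (CycAdjFin ℓ a) (sym (g-injective _ _ eq)) (next-adjacent a)
    ... | inj₂ eq = subst (CycAdjFin ℓ a) (sym (g-injective _ _ eq)) (previous-adjacent a)

    j : Fin (length L)
    j = proj₁ (g 0z)

    m : ℕ
    m = lookup L j

    component-g : ∀ a → component (g a) ≡ toℕ j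
    component-g a = subst (λ b → component (g b) ≡ toℕ j) (fromℕ<-toℕ a (toℕ<n a)) (walk (toℕ a) (toℕ<n a))
      where
      walk : ∀ t (t<ℓ : t < ℓ) → component (g (fromℕ< t<ℓ)) ≡ toℕ j
      walk zero _ = refl
      walk (suc t) t+1<ℓ = trans (sym (proj₁ (g-adjacent _ _ t~t+1))) (walk t t<ℓ)
        where
        t<ℓ : t < ℓ
        t<ℓ = ℕ.<-trans (ℕ.n<1+n t) t+1<ℓ
        t~t+1 : CycAdjFin ℓ (fromℕ< t<ℓ) (fromℕ< t+1<ℓ)
        t~t+1 = inj₁ (trans (toℕ-fromℕ< t+1<ℓ) (cong suc (sym (toℕ-fromℕ< t<ℓ))))

    proj₁-g : ∀ a → proj₁ (g a) ≡ j
    proj₁-g a = toℕ-injective (component-g a)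

    position<m : ∀ a → position (g a) < m
    position<m a = subst (λ i → position (g a) < lookup L i) (proj₁-g a) (toℕ<n (proj₂ (g a)))

    g-≡ : ∀ a (v : Fin m) → position (g a) ≡ toℕ v → g a ≡ (j , v)
    g-≡ a v eq = CycVtx-≡ {L} (component-g a) eq

    Hit : ℕ → Set
    Hit v = ∃ λ a → position (g a) ≡ v

    hit-neighbour : ∀ a (y : Fin m) → H (g a) (j , y) → Hit (toℕ y)
    hit-neighbour a y e with g-neighbour a e
    ... | inj₁ eq = a ⊕ one , cong position (sym eq)
    ... | inj₂ eq = a ⊖ one , cong position (sym eq)

    hit-suc : ∀ {v} → Hit v → (v+1<m : suc v < m) → Hit (suc v)
    hit-suc (a , refl) v+1<m = subst Hit (toℕ-fromℕ< v+1<m)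
      (hit-neighbour a (fromℕ< v+1<m) (component-g a , inj₁ (trans (toℕ-fromℕ< v+1<m) refl)))

    hit-pred : ∀ {v} → Hit (suc v) → Hit v
    hit-pred {v} (a , eq) = subst Hit (toℕ-fromℕ< v<m)
      (hit-neighbour a (fromℕ< v<m) (component-g a , inj₂ (inj₁ (trans eq (cong suc (sym (toℕ-fromℕ< v<m)))))))
      where
      v<m : v < m
      v<m = ℕ.<-trans (ℕ.n<1+n v) (subst (_< m) eq (position<m a))

    hit-below : ∀ k v → Hit (k + v) → Hit v
    hit-below zero v hit = hit
    hit-below (suc k) v hit = hit-below k v (hit-pred hit)

    hit-< : ∀ v → v < m → Hit v
    hit-< zero _ = hit-below (position (g 0z)) 0 (0z , sym (ℕ.+-identityʳ _))
    hit-< (suc v) v+1<m = hit-suc (hit-< v (ℕ.<-trans (ℕ.n<1+n v) v+1<m)) v+1<m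

    m≡ℓ : m ≡ ℓ
    m≡ℓ = ℕ.≤-antisym (injective⇒≤ {f = preimage} preimage-injective) (injective⇒≤ {f = pos} pos-injective)
      where
      preimage : Fin m → Fin ℓ
      preimage v = proj₁ (hit-< (toℕ v) (toℕ<n v))
      preimage-injective : ∀ {v w} → preimage v ≡ preimage w → v ≡ w
      preimage-injective {v} {w} eq = toℕ-injective (trans (sym (proj₂ (hit-< (toℕ v) (toℕ<n v))))
        (trans (cong (λ a → position (g a)) eq) (proj₂ (hit-< (toℕ w) (toℕ<n w)))))
      pos : Fin ℓ → Fin m
      pos a = fromℕ< (position<m a)
      pos-injective : ∀ {a b} → pos a ≡ pos b → a ≡ b
      pos-injective {a} {b} eq = g-injective a b (trans (g-≡ a (pos a) (sym (toℕ-fromℕ< _)))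
        (trans (cong (j ,_) eq) (sym (g-≡ b (pos b) (sym (toℕ-fromℕ< _))))))

    lookup-≡ℓ : ∀ {i} → toℕ i ≡ toℕ j → lookup L i ≡ ℓ
    lookup-≡ℓ i≡j = trans (cong (lookup L) (toℕ-injective i≡j)) m≡ℓ

    lookup-0 : ∀ x → component x ≡ 0 → lookup L (proj₁ x) ≡ ℓ
    lookup-0 x x∈0 = cong (lookup L) (toℕ-injective {j = fzero} x∈0)

    -- δ maps component 0 onto the cycle g, moves component j to component 0 and fixes all other
    -- components; as g fills the whole component j, δ is an automorphism of H.
    δ-outside-0 : (i : Fin (length L)) → Fin (lookup L i) → Dec (toℕ i ≡ toℕ j) → CycVtx L
    δ-outside-0 i v (yes i≡j) = fzero , fromℕ< (subst (toℕ v <_) (lookup-≡ℓ i≡j) (toℕ<n v))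
    δ-outside-0 i v (no _) = i , v

    δ : CycVtx L → CycVtx L
    δ (fzero , a) = g a
    δ (fsuc i , v) = δ-outside-0 (fsuc i) v (toℕ (fsuc i) ℕ.≟ toℕ j)

    Moved Fixed : (i : Fin (length L)) → Fin (lookup L i) → Set
    Moved i v = toℕ i ≡ toℕ j × component (δ (i , v)) ≡ 0 × position (δ (i , v)) ≡ toℕ v
    Fixed i v = toℕ i ≢ toℕ j × δ (i , v) ≡ (i , v)

    moved-or-fixed : ∀ i v → toℕ i ≢ 0 → Moved i v ⊎ Fixed i v
    moved-or-fixed fzero v i≢0 = ⊥-elim (i≢0 refl)
    moved-or-fixed (fsuc i) v _ with toℕ (fsuc i) ℕ.≟ toℕ j
    ... | yes i≡j = inj₁ (i≡j , refl , toℕ-fromℕ< _)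
    ... | no i≢j = inj₂ (i≢j , refl)

    into-j : ∀ {i} → toℕ i ≡ 0 → Fin (lookup L i) → Fin m
    into-j {i} i≡0 v = fromℕ< (subst (toℕ v <_) (trans (lookup-0 (i , v) i≡0) (sym m≡ℓ)) (toℕ<n v))

    δ⁻¹-case : (i : Fin (length L)) → Fin (lookup L i) → Dec (toℕ i ≡ toℕ j) → Dec (toℕ i ≡ 0) → CycVtx L
    δ⁻¹-case i v (yes i≡j) _ = fzero , proj₁ (hit-< (toℕ v) (subst (toℕ v <_) (cong (lookup L) (toℕ-injective i≡j)) (toℕ<n v)))
    δ⁻¹-case i v (no _) (yes i≡0) = j , into-j i≡0 v
    δ⁻¹-case i v (no _) (no _) = i , v

    δ⁻¹ : CycVtx L → CycVtx L
    δ⁻¹ (i , v) = δ⁻¹-case i v (toℕ i ℕ.≟ toℕ j) (toℕ i ℕ.≟ 0)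

    δ-δ⁻¹ : ∀ y → δ (δ⁻¹ y) ≡ y
    δ-δ⁻¹ (i , v) = go (toℕ i ℕ.≟ toℕ j) (toℕ i ℕ.≟ 0)
      where
      go : (i≟j : Dec (toℕ i ≡ toℕ j)) (i≟0 : Dec (toℕ i ≡ 0)) → δ (δ⁻¹-case i v i≟j i≟0) ≡ (i , v)
      go (yes i≡j) _ = CycVtx-≡ {L} (trans (component-g (proj₁ hit)) (sym i≡j)) (proj₂ hit)
        where
        hit : Hit (toℕ v)
        hit = hit-< (toℕ v) (subst (toℕ v <_) (cong (lookup L) (toℕ-injective i≡j)) (toℕ<n v))
      go (no i≢j) (yes i≡0) with moved-or-fixed j (into-j i≡0 v) (λ j≡0 → i≢j (trans i≡0 (sym j≡0)))
      ... | inj₁ (_ , δ∈0 , position≡) = CycVtx-≡ {L} (trans δ∈0 (sym i≡0)) (trans position≡ (toℕ-fromℕ< _))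
      ... | inj₂ (j≢j , _) = ⊥-elim (j≢j refl)
      go (no i≢j) (no i≢0) with moved-or-fixed i v i≢0
      ... | inj₁ (i≡j , _) = ⊥-elim (i≢j i≡j)
      ... | inj₂ (_ , fixed) = fixed

    g-not-outside-0 : ∀ a i v → component (g a) ≢ component (δ (fsuc i , v))
    g-not-outside-0 a i v g≡δ with moved-or-fixed (fsuc i) v ℕ.1+n≢0
    ... | inj₁ (i≡j , δ∈0 , _) = ℕ.1+n≢0 (trans i≡j (trans (sym (component-g a)) (trans g≡δ δ∈0)))
    ... | inj₂ (i≢j , fixed) = i≢j (sym (trans (sym (component-g a)) (trans g≡δ (cong component fixed))))

    moved-not-fixed : ∀ {i v i′ v′} → Moved i v → Fixed (fsuc i′) v′ → component (δ (i , v)) ≢ component (δ (fsuc i′ , v′))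
    moved-not-fixed (_ , δ∈0 , _) (_ , fixed) δ≡δ′ = ℕ.0≢1+n (trans (sym δ∈0) (trans δ≡δ′ (cong component fixed)))

    δ-injective : ∀ x y → δ x ≡ δ y → x ≡ y
    δ-injective (fzero , a) (fzero , b) eq = cong (fzero ,_) (g-injective a b eq)
    δ-injective (fzero , a) (fsuc i , v) eq = ⊥-elim (g-not-outside-0 a i v (cong component eq))
    δ-injective (fsuc i , v) (fzero , a) eq = ⊥-elim (g-not-outside-0 a i v (cong component (sym eq)))
    δ-injective (fsuc i , v) (fsuc i′ , v′) eq with moved-or-fixed (fsuc i) v ℕ.1+n≢0 | moved-or-fixed (fsuc i′) v′ ℕ.1+n≢0
    ... | inj₁ (i≡j , _ , position≡) | inj₁ (i′≡j , _ , position′≡) =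
      CycVtx-≡ {L} (trans i≡j (sym i′≡j)) (trans (sym position≡) (trans (cong position eq) position′≡))
    ... | inj₁ moved | inj₂ fixed = ⊥-elim (moved-not-fixed moved fixed (cong component eq))
    ... | inj₂ fixed | inj₁ moved = ⊥-elim (moved-not-fixed moved fixed (cong component (sym eq)))
    ... | inj₂ (_ , fixed) | inj₂ (_ , fixed′) = trans (sym fixed) (trans eq fixed′)

    δ-preserves : ∀ x y → H x y → H (δ x) (δ y)
    δ-preserves (fzero , a) (fzero , b) (_ , adj) = g-adjacent a b adj
    δ-preserves (fsuc i , v) (fsuc i′ , v′) (i≡i′ , adj) with moved-or-fixed (fsuc i) v ℕ.1+n≢0 | moved-or-fixed (fsuc i′) v′ ℕ.1+n≢0
    ... | inj₁ (i≡j , δ∈0 , position≡) | inj₁ (_ , δ′∈0 , position′≡) = trans δ∈0 (sym δ′∈0) ,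
      CycAdjℕ-cong (trans (lookup-≡ℓ i≡j) (sym (lookup-0 (δ (fsuc i , v)) δ∈0))) (sym position≡) (sym position′≡) adj
    ... | inj₁ (i≡j , _) | inj₂ (i′≢j , _) = ⊥-elim (i′≢j (trans (sym i≡i′) i≡j))
    ... | inj₂ (i≢j , _) | inj₁ (i′≡j , _) = ⊥-elim (i≢j (trans i≡i′ i′≡j))
    ... | inj₂ (_ , fixed) | inj₂ (_ , fixed′) = subst₂ H (sym fixed) (sym fixed′) (i≡i′ , adj)

    δ-reflects : ∀ x y → H (δ x) (δ y) → H x y
    δ-reflects (fzero , a) (fzero , b) e = refl , g-reflects a b e
    δ-reflects (fzero , a) (fsuc i , v) e = ⊥-elim (g-not-outside-0 a i v (proj₁ e))
    δ-reflects (fsuc i , v) (fzero , a) e = ⊥-elim (g-not-outside-0 a i v (sym (proj₁ e)))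
    δ-reflects (fsuc i , v) (fsuc i′ , v′) e with moved-or-fixed (fsuc i) v ℕ.1+n≢0 | moved-or-fixed (fsuc i′) v′ ℕ.1+n≢0
    ... | inj₁ (i≡j , δ∈0 , position≡) | inj₁ (i′≡j , _ , position′≡) = trans i≡j (sym i′≡j) ,
      CycAdjℕ-cong (trans (lookup-0 (δ (fsuc i , v)) δ∈0) (sym (lookup-≡ℓ i≡j))) position≡ position′≡ (proj₂ e)
    ... | inj₁ moved | inj₂ fixed = ⊥-elim (moved-not-fixed moved fixed (proj₁ e))
    ... | inj₂ fixed | inj₁ moved = ⊥-elim (moved-not-fixed moved fixed (sym (proj₁ e)))
    ... | inj₂ (_ , fixed) | inj₂ (_ , fixed′) = subst₂ H fixed fixed′ e

    δ⁻¹-↔ : CycVtx L ↔ CycVtx L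
    δ⁻¹-↔ = mk↔ₛ′ δ⁻¹ δ (λ x → δ-injective _ _ (δ-δ⁻¹ (δ x))) δ-δ⁻¹

    δ⁻¹-automorphism : H ≅ H
    δ⁻¹-automorphism = δ⁻¹-↔ , λ x y →
      mk⇔ (λ e → δ-reflects _ _ (subst₂ H (sym (δ-δ⁻¹ x)) (sym (δ-δ⁻¹ y)) e))
          (λ e → subst₂ H (δ-δ⁻¹ x) (δ-δ⁻¹ y) (δ-preserves _ _ e))

    δ⁻¹-g : ∀ a → δ⁻¹ (g a) ≡ (fzero , a)
    δ⁻¹-g a = δ-injective _ _ (δ-δ⁻¹ (g a))

  normalise : ∀ {V : Set} {Γ : Graph V} → Γ ≅ Cyc L → (C : CycleIn Γ ℓ) →
              Σ (Γ ≅ Cyc L) λ f → ∀ a → Inverse.to (proj₁ f) (CycleIn.c C a) ≡ (fzero , a)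
  normalise (f , f-iso) C = ≅-trans {G = H} {H = H} (f , f-iso) δ⁻¹-automorphism , δ⁻¹-g
    where
    open OfCycle (λ a → Inverse.to f (CycleIn.c C a))
                 (λ a b eq → CycleIn.inj C a b (to-injective f eq))
                 (λ a b ab → Equivalence.to (f-iso _ _) (CycleIn.edges C a b ab))

Cyc-sym : ∀ L {x y} → Cyc L x y → Cyc L y x
Cyc-sym L (i≡j , adj) = sym i≡j , subst (λ ℓ → CycAdjℕ ℓ _ _) (cong (lookup L) (toℕ-injective i≡j)) (CycAdjℕ-sym adj)

-- nothing is the new vertex on the edge PQ.
Subdivide : {V : Set} → Graph V → V → V → Graph (Maybe V)
Subdivide G P Q (just u) (just w) = G u w × ¬ ((u ≡ P × w ≡ Q) ⊎ (u ≡ Q × w ≡ P))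
Subdivide G P Q nothing (just u) = (u ≡ P) ⊎ (u ≡ Q)
Subdivide G P Q (just u) nothing = (u ≡ P) ⊎ (u ≡ Q)
Subdivide G P Q nothing nothing = ⊥

Subdivide-swap : {V : Set} (G : Graph V) (P Q : V) → ∀ x y → Subdivide G P Q x y ⇔ Subdivide G Q P x y
Subdivide-swap G P Q (just u) (just w) = mk⇔ (λ (e , ¬PQ) → e , ¬PQ ∘ ⊎-swap) (λ (e , ¬QP) → e , ¬QP ∘ ⊎-swap)
Subdivide-swap G P Q nothing (just u) = mk⇔ ⊎-swap ⊎-swap
Subdivide-swap G P Q (just u) nothing = mk⇔ ⊎-swap ⊎-swap
Subdivide-swap G P Q nothing nothing = mk⇔ (λ ()) (λ ())

Subdivide-≅ : {V W : Set} {G : Graph V} {H : Graph W} (f : G ≅ H) (P Q : V) →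
  Subdivide G P Q ≅ Subdivide H (Inverse.to (proj₁ f) P) (Inverse.to (proj₁ f) Q)
Subdivide-≅ {V} {W} {G} {H} (f , G⇔H) P Q = Maybe-↔ f , iso
  where
  t : V → W
  t = Inverse.to f
  t-injective : ∀ {x y} → t x ≡ t y → x ≡ y
  t-injective = to-injective f
  map-end : ∀ {u} → (u ≡ P) ⊎ (u ≡ Q) → (t u ≡ t P) ⊎ (t u ≡ t Q)
  map-end (inj₁ e) = inj₁ (cong t e)
  map-end (inj₂ e) = inj₂ (cong t e)
  unmap-end : ∀ {u} → (t u ≡ t P) ⊎ (t u ≡ t Q) → (u ≡ P) ⊎ (u ≡ Q)
  unmap-end (inj₁ e) = inj₁ (t-injective e)
  unmap-end (inj₂ e) = inj₂ (t-injective e)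
  iso : ∀ x y → Subdivide G P Q x y ⇔ Subdivide H (t P) (t Q) (Maybe.map t x) (Maybe.map t y)
  iso (just u) (just w) = mk⇔
    (λ (e , ¬PQ) → Equivalence.to (G⇔H u w) e , λ
      { (inj₁ (a , b)) → ¬PQ (inj₁ (t-injective a , t-injective b))
      ; (inj₂ (a , b)) → ¬PQ (inj₂ (t-injective a , t-injective b)) })
    (λ (e , ¬PQ) → Equivalence.from (G⇔H u w) e , λ
      { (inj₁ (a , b)) → ¬PQ (inj₁ (cong t a , cong t b))
      ; (inj₂ (a , b)) → ¬PQ (inj₂ (cong t a , cong t b)) })
  iso nothing (just u) = mk⇔ map-end unmap-end
  iso (just u) nothing = mk⇔ map-end unmap-end
  iso nothing nothing = mk⇔ (λ ()) (λ ())

module CycleSubdivision (q : ℕ) (rest : List ℕ) where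
  open CycleArithmetic q
  open CycleNormalisation q rest using (L; position)

  L′ : List ℕ
  L′ = suc ℓ ∷ rest

  subdivision-↔ : Maybe (CycVtx L) ↔ CycVtx L′
  subdivision-↔ = mk↔ₛ′ to from to-from from-to
    where
    to : Maybe (CycVtx L) → CycVtx L′
    to nothing = fzero , fzero
    to (just (fzero , a)) = fzero , fsuc a
    to (just (fsuc i , v)) = fsuc i , v
    from : CycVtx L′ → Maybe (CycVtx L)
    from (fzero , fzero) = nothing
    from (fzero , fsuc a) = just (fzero , a)
    from (fsuc i , v) = just (fsuc i , v)
    to-from : ∀ y → to (from y) ≡ y
    to-from (fzero , fzero) = refl
    to-from (fzero , fsuc a) = refl
    to-from (fsuc i , v) = refl
    from-to : ∀ x → from (to x) ≡ x
    from-to nothing = refl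
    from-to (just (fzero , a)) = refl
    from-to (just (fsuc i , v)) = refl

  P₀ Q₀ : CycVtx L
  P₀ = fzero , last
  Q₀ = fzero , 0z

  toℕ-last : toℕ last ≡ suc (suc q)
  toℕ-last = toℕ-fromℕ (suc (suc q))

  ≡P₀ : ∀ {a} → suc (toℕ a) ≡ ℓ → (fzero , a) ≡ P₀
  ≡P₀ a+1≡ℓ = cong (fzero ,_) (toℕ-injective (trans (ℕ.suc-injective a+1≡ℓ) (sym toℕ-last)))

  ≡Q₀ : ∀ {a} → toℕ a ≡ 0 → (fzero , a) ≡ Q₀
  ≡Q₀ a≡0 = cong (fzero ,_) (toℕ-injective {j = 0z} a≡0)

  successor-not-P₀Q₀ : ∀ {a b} → toℕ b ≡ suc (toℕ a) →
    ¬ ((((fzero , a) ≡ P₀) × ((fzero , b) ≡ Q₀)) ⊎ (((fzero , a) ≡ Q₀) × ((fzero , b) ≡ P₀)))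
  successor-not-P₀Q₀ b≡a+1 (inj₁ (_ , b≡Q₀)) = ℕ.1+n≢0 (trans (sym b≡a+1) (cong position b≡Q₀))
  successor-not-P₀Q₀ b≡a+1 (inj₂ (a≡Q₀ , b≡P₀)) =
    ℕ.0≢1+n (ℕ.suc-injective (trans (sym (trans b≡a+1 (cong (suc ∘ position) a≡Q₀))) (trans (cong position b≡P₀) toℕ-last)))

  Cyc-subdivide : Subdivide (Cyc L) P₀ Q₀ ≅ Cyc L′
  Cyc-subdivide = subdivision-↔ , iso
    where
    to : Maybe (CycVtx L) → CycVtx L′
    to = Inverse.to subdivision-↔
    new-edge : ∀ a → (((fzero , a) ≡ P₀) ⊎ ((fzero , a) ≡ Q₀)) ⇔ Cyc L′ (fzero , fzero) (fzero , fsuc a)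
    new-edge a = mk⇔
      (λ { (inj₁ a≡P₀) → refl , inj₂ (inj₂ (inj₂ (cong (suc ∘ suc) (trans (cong position a≡P₀) toℕ-last) , refl)))
         ; (inj₂ a≡Q₀) → refl , inj₁ (cong suc (cong position a≡Q₀)) })
      (λ { (_ , inj₁ a+1≡1) → inj₂ (≡Q₀ (ℕ.suc-injective a+1≡1))
         ; (_ , inj₂ (inj₁ ()))
         ; (_ , inj₂ (inj₂ (inj₁ (() , _))))
         ; (_ , inj₂ (inj₂ (inj₂ (a+2≡ℓ+1 , _)))) → inj₁ (≡P₀ (ℕ.suc-injective a+2≡ℓ+1)) })
    old-edge : ∀ a b → Subdivide (Cyc L) P₀ Q₀ (just (fzero , a)) (just (fzero , b)) ⇔ Cyc L′ (fzero , fsuc a) (fzero , fsuc b)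
    old-edge a b = mk⇔
      (λ { ((_ , inj₁ b≡a+1) , _) → refl , inj₁ (cong suc b≡a+1)
         ; ((_ , inj₂ (inj₁ a≡b+1)) , _) → refl , inj₂ (inj₁ (cong suc a≡b+1))
         ; ((_ , inj₂ (inj₂ (inj₁ (a+1≡ℓ , b≡0)))) , ¬P₀Q₀) → ⊥-elim (¬P₀Q₀ (inj₁ (≡P₀ a+1≡ℓ , ≡Q₀ b≡0)))
         ; ((_ , inj₂ (inj₂ (inj₂ (b+1≡ℓ , a≡0)))) , ¬P₀Q₀) → ⊥-elim (¬P₀Q₀ (inj₂ (≡Q₀ a≡0 , ≡P₀ b+1≡ℓ))) })
      (λ { (_ , inj₁ b≡a+1) → (refl , inj₁ (ℕ.suc-injective b≡a+1)) , successor-not-P₀Q₀ (ℕ.suc-injective b≡a+1)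
         ; (_ , inj₂ (inj₁ a≡b+1)) → (refl , inj₂ (inj₁ (ℕ.suc-injective a≡b+1))) ,
             λ P₀Q₀ → successor-not-P₀Q₀ (ℕ.suc-injective a≡b+1) (⊎-swap (⊎-map swap swap P₀Q₀))
         ; (_ , inj₂ (inj₂ (inj₁ (_ , ()))))
         ; (_ , inj₂ (inj₂ (inj₂ (_ , ())))) })
    iso : ∀ x y → Subdivide (Cyc L) P₀ Q₀ x y ⇔ Cyc L′ (to x) (to y)
    iso nothing nothing = mk⇔ (λ ())
      λ { (_ , inj₁ ()) ; (_ , inj₂ (inj₁ ())) ; (_ , inj₂ (inj₂ (inj₁ (() , _)))) ; (_ , inj₂ (inj₂ (inj₂ (() , _)))) }
    iso nothing (just (fzero , a)) = new-edge a
    iso (just (fzero , a)) nothing =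
      mk⇔ (λ e → Cyc-sym L′ (Equivalence.to (new-edge a) e)) (λ e → Equivalence.from (new-edge a) (Cyc-sym L′ e))
    iso nothing (just (fsuc i , v)) = mk⇔ (λ { (inj₁ ()) ; (inj₂ ()) }) (λ { (() , _) })
    iso (just (fsuc i , v)) nothing = mk⇔ (λ { (inj₁ ()) ; (inj₂ ()) }) (λ { (() , _) })
    iso (just (fzero , a)) (just (fzero , b)) = old-edge a b
    iso (just (fzero , a)) (just (fsuc i , v)) = mk⇔ (λ { ((() , _) , _) }) (λ { (() , _) })
    iso (just (fsuc i , v)) (just (fzero , a)) = mk⇔ (λ { ((() , _) , _) }) (λ { (() , _) })
    iso (just (fsuc i , v)) (just (fsuc i′ , v′)) = mk⇔ (λ (e , _) → e) (λ e → e , λ { (inj₁ (() , _)) ; (inj₂ (() , _)) })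

  subdivide-cycle-edge : ∀ {V : Set} {Γ : Graph V} → Γ ≅ Cyc L → (C : CycleIn Γ ℓ) → ∀ a b → CycAdjFin ℓ a b →
                         Subdivide Γ (CycleIn.c C a) (CycleIn.c C b) ≅ Cyc L′
  subdivide-cycle-edge {V} {Γ} Γ≅L C a b ab with rotate-to-edge C a b ab
  ... | C′ , orientation = orient orientation
    where
    open CycleNormalisation q rest using (normalise)
    P Q : V
    P = CycleIn.c C′ last
    Q = CycleIn.c C′ 0z
    f : Γ ≅ Cyc L
    f = proj₁ (normalise Γ≅L C′)
    f-fixes : ∀ a → Inverse.to (proj₁ f) (CycleIn.c C′ a) ≡ (fzero , a)
    f-fixes = proj₂ (normalise Γ≅L C′)
    PQ-≅ : Subdivide Γ P Q ≅ Cyc L′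
    PQ-≅ = ≅-trans {H = Cyc L′} (Subdivide-≅ f P Q)
      (subst₂ (λ A B → Subdivide (Cyc L) A B ≅ Cyc L′) (sym (f-fixes last)) (sym (f-fixes 0z)) Cyc-subdivide)
    orient : ((P ≡ CycleIn.c C a) × (Q ≡ CycleIn.c C b)) ⊎ ((P ≡ CycleIn.c C b) × (Q ≡ CycleIn.c C a)) →
             Subdivide Γ (CycleIn.c C a) (CycleIn.c C b) ≅ Cyc L′
    orient (inj₁ (P≡a , Q≡b)) = subst₂ (λ A B → Subdivide Γ A B ≅ Cyc L′) P≡a Q≡b PQ-≅
    orient (inj₂ (P≡b , Q≡a)) = ≅-respˡ {H = Cyc L′} (Subdivide-swap Γ _ _)
      (subst₂ (λ A B → Subdivide Γ A B ≅ Cyc L′) P≡b Q≡a PQ-≅)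

-- Factorisations of K_{2n+2}

module Extension (m : ℕ) (F : Graph (Vtx (suc m))) (F-simple : IsSimple F) (F-deg : MaxDegree2 F)
  (x₀ x₁ : Fin (suc m)) (∞x₀ : F ∞ (pt 𝟘 x₀)) (∞x₁ : F ∞ (pt 𝟙 x₁))
  (factorisation : BaseFactor.CyclicFactorisation m F F-simple F-deg x₀ x₁ ∞x₀ ∞x₁)
  (L′ : List ℕ) (x y : Fin (suc m)) (xy : F (pt 𝟘 x) (pt 𝟙 y))
  (G′≅L′ : Subdivide F (pt 𝟘 x) (pt 𝟙 y) ≅ Cyc L′) where

  open Cyclic m using (N; Z)
  open Translation m using (IsEndOf)
  open BaseFactor m F F-simple F-deg x₀ x₁ ∞x₀ ∞x₁ using (F-sym; F-irrefl; module CyclicFactorisation)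
  open CyclicFactorisation factorisation

  p q : Vtx N
  p = pt 𝟘 x
  q = pt 𝟙 y

  ψ-to : Z → Vtx N → Vtx N
  ψ-to i = Inverse.to (ψ i)

  G′ : Graph (Maybe (Vtx N))
  G′ = Subdivide F p q

  IsPQ : Vtx N → Vtx N → Set
  IsPQ u w = (u ≡ p × w ≡ q) ⊎ (u ≡ q × w ≡ p)

  removed : Graph (Maybe (Vtx N))
  removed (just u) (just w) = ∃ λ i → IsPQ (ψ-to i u) (ψ-to i w)
  removed nothing (just u) = u ≡ ∞
  removed (just u) nothing = u ≡ ∞
  removed nothing nothing = ⊥

  IsPQ⇒F : ∀ {u w} → IsPQ u w → F u w
  IsPQ⇒F (inj₁ (refl , refl)) = xy
  IsPQ⇒F (inj₂ (refl , refl)) = F-sym xy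

  IsPQ-sym : ∀ {u w} → IsPQ u w → IsPQ w u
  IsPQ-sym = ⊎-swap ∘ ⊎-map swap swap

  IsPQ⇒IsEndOf : ∀ {u w} → IsPQ u w → IsEndOf x y u
  IsPQ⇒IsEndOf (inj₁ (u≡p , _)) = inj₁ u≡p
  IsPQ⇒IsEndOf (inj₂ (u≡q , _)) = inj₂ u≡q

  ∞-not-end : ¬ IsEndOf x y ∞
  ∞-not-end (inj₁ ())
  ∞-not-end (inj₂ ())

  ψ-∞-not-end : ∀ i → ¬ IsEndOf x y (ψ-to i ∞)
  ψ-∞-not-end i end = ∞-not-end (subst (IsEndOf x y) (ψ-∞ i) end)

  G′-sym : ∀ {u w} → G′ u w → G′ w u
  G′-sym {just u} {just w} (e , ¬PQ) = F-sym e , λ pq → ¬PQ (IsPQ-sym pq)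
  G′-sym {nothing} {just u} e = e
  G′-sym {just u} {nothing} e = e

  G′-irrefl : ∀ {u} → ¬ G′ u u
  G′-irrefl {just u} (e , _) = F-irrefl e

  removed-sym : ∀ {u w} → removed u w → removed w u
  removed-sym {just u} {just w} (i , pq) = i , IsPQ-sym pq
  removed-sym {nothing} {just u} e = e
  removed-sym {just u} {nothing} e = e

  removed-irrefl : ∀ {u} → ¬ removed u u
  removed-irrefl {just u} (i , inj₁ (u≡p , u≡q)) with trans (sym u≡p) u≡q
  ... | ()
  removed-irrefl {just u} (i , inj₂ (u≡q , u≡p)) with trans (sym u≡p) u≡q
  ... | ()

  ψ-from : Z → Vtx N → Vtx N
  ψ-from i = Inverse.from (ψ i)

  ψ-to-from : ∀ i v → ψ-to i (ψ-from i v) ≡ v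
  ψ-to-from i = Inverse.strictlyInverseˡ (ψ i)

  removed-perfect : ∀ u → ∃ λ w → removed u w
  removed-perfect nothing = just ∞ , refl
  removed-perfect (just ∞) = nothing , refl
  removed-perfect (just (pt s a)) with ends-cover x y xy (pt s a) (λ ())
  ... | i , inj₁ u↦p = just (ψ-from i q) , i , inj₁ (u↦p , ψ-to-from i q)
  ... | i , inj₂ u↦q = just (ψ-from i p) , i , inj₂ (u↦q , ψ-to-from i p)

  removed-unique : ∀ u w w′ → removed u w → removed u w′ → w ≡ w′
  removed-unique nothing (just _) (just _) refl refl = refl
  removed-unique (just ∞) nothing nothing _ _ = refl
  removed-unique (just ∞) (just _) _ (i , pq) _ = ⊥-elim (ψ-∞-not-end i (IsPQ⇒IsEndOf pq))
  removed-unique (just ∞) nothing (just _) _ (i , pq) = ⊥-elim (ψ-∞-not-end i (IsPQ⇒IsEndOf pq))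
  removed-unique (just (pt s a)) (just w) (just w′) (i , pq) (j , pq′)
    with ends-unique x y xy (pt s a) i j (IsPQ⇒IsEndOf pq) (IsPQ⇒IsEndOf pq′)
  ... | refl = cong just (to-injective (ψ i) (partner pq pq′))
    where
    partner : IsPQ (ψ-to i (pt s a)) (ψ-to i w) → IsPQ (ψ-to i (pt s a)) (ψ-to i w′) → ψ-to i w ≡ ψ-to i w′
    partner (inj₁ (_ , w↦q)) (inj₁ (_ , w′↦q)) = trans w↦q (sym w′↦q)
    partner (inj₂ (_ , w↦p)) (inj₂ (_ , w′↦p)) = trans w↦p (sym w′↦p)
    partner (inj₁ (u↦p , _)) (inj₂ (u↦q , _)) with trans (sym u↦p) u↦q
    ... | ()
    partner (inj₂ (u↦q , _)) (inj₁ (u↦p , _)) with trans (sym u↦p) u↦q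
    ... | ()

  order-L′ : sum L′ ≡ suc (suc (N + N))
  order-L′ = order-≅ {L = L′} (Maybe-Fin↔Fin (suc (N + N)) ↔-∘ Maybe-↔ (Vtx↔Fin N)) G′≅L′

  extended-solution : PermutationSolution L′ (Maybe (Vtx N))
  extended-solution = record
    { base = G′
    ; baseSimple = record { sym = G′-sym ; irrefl = G′-irrefl }
    ; baseIso = G′≅L′
    ; k = N
    ; ψ = λ i → Maybe-↔ (ψ i)
    ; removed = removed
    ; removedOK = (λ 2∤ → ⊥-elim (2∤ (subst (2 ∣_) (sym order-L′) (2∣2+n+n N)))) ,
                  (λ _ → record { sym = removed-sym ; irrefl = removed-irrefl } , removed-perfect , removed-unique)
    ; cover = cover′
    ; avoid = avoid′
    ; disjoint = disjoint′
    }
    where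
    cover′ : ∀ u w → u ≢ w → ¬ removed u w → ∃ λ i → G′ (Maybe.map (ψ-to i) u) (Maybe.map (ψ-to i) w)
    cover′ nothing nothing u≢w _ = ⊥-elim (u≢w refl)
    cover′ nothing (just ∞) _ ¬rem = ⊥-elim (¬rem refl)
    cover′ nothing (just (pt s a)) _ _ = ends-cover x y xy (pt s a) (λ ())
    cover′ (just ∞) nothing _ ¬rem = ⊥-elim (¬rem refl)
    cover′ (just (pt s a)) nothing _ _ = ends-cover x y xy (pt s a) (λ ())
    cover′ (just u) (just w) u≢w ¬rem with cover u w (λ eq → u≢w (cong just eq))
    ... | i , e = i , e , λ pq → ¬rem (i , pq)
    avoid′ : ∀ i u w → G′ (Maybe.map (ψ-to i) u) (Maybe.map (ψ-to i) w) → ¬ removed u w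
    avoid′ i (just u) (just w) (e , ¬pq) (j , pq) with disjoint i j u w e (IsPQ⇒F pq)
    ... | refl = ¬pq pq
    avoid′ i nothing (just u) end refl = ψ-∞-not-end i end
    avoid′ i (just u) nothing end refl = ψ-∞-not-end i end
    disjoint′ : ∀ i j u w → G′ (Maybe.map (ψ-to i) u) (Maybe.map (ψ-to i) w) →
                G′ (Maybe.map (ψ-to j) u) (Maybe.map (ψ-to j) w) → i ≡ j
    disjoint′ i j (just u) (just w) (e , _) (e′ , _) = disjoint i j u w e e′
    disjoint′ i j nothing (just u) end end′ = ends-unique x y xy u i j end end′
    disjoint′ i j (just u) nothing end end′ = ends-unique x y xy u i j end end′

proposition5 : (n : ℕ) → 1 ≤ n → (ℓ₁ : ℕ) → (rest : List ℕ) →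
    CycleLengths (ℓ₁ ∷ rest) →
    (F : Graph (Vtx n)) → IsSimple F → F ≅ Cyc (ℓ₁ ∷ rest) →
    (∃ λ x₀ → ∃ λ x₁ → F ∞ (pt 𝟘 x₀) × F ∞ (pt 𝟙 x₁)) →
    (¬ (2 ∣ n) →
       ΔIs n F 𝟘 𝟘 (λ d → toℕ d ≢ 0) ×
       ΔIs n F 𝟙 𝟙 (λ d → toℕ d ≢ 0) ×
       ΔIs n F 𝟘 𝟙 (λ _ → ⊤)) →
    ((z h : Fin n) → toℕ z ≡ 0 → toℕ h + toℕ h ≡ n →
       (F (pt 𝟘 z) (pt 𝟘 h) × F (pt 𝟘 h) (pt 𝟙 h) × F (pt 𝟙 h) (pt 𝟙 z)) ×
       ΔIs n (F minusP (z , h)) 𝟘 𝟘 (λ d → toℕ d ≢ 0 × d ≢ h) ×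
       ΔIs n (F minusP (z , h)) 𝟘 𝟙 (λ d → toℕ d ≢ 0 × d ≢ h) ×
       ΔIs n (F minusP (z , h)) 𝟙 𝟙 (λ d → toℕ d ≢ 0 × d ≢ h)) →
    OP (ℓ₁ ∷ rest) ×
    ((C : CycleIn F ℓ₁) →
       (∃ λ d → InΔ01 C d × ((h : Fin n) → toℕ h + toℕ h ≡ n → d ≢ h)) →
       OP (ℓ₁ + 1 ∷ rest))
proposition5 (suc m) (s≤s z≤n) _ rest (s≤s (s≤s (s≤s {n = q} z≤n)) ∷ _) F F-simple F≅L (x₀ , x₁ , ∞x₀ , ∞x₁) odd even =
  PermutationSolution⇒OP (CyclicFactorisation⇒PermutationSolution F≅L factorisation) , extension
  where
  open CycleArithmetic q using (ℓ)
  F-deg : MaxDegree2 F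
  F-deg = ≅-maxDegree2 {H = Cyc (ℓ ∷ rest)} F≅L (Cyc-maxDegree2 (ℓ ∷ rest))
  open BaseFactor m F F-simple F-deg x₀ x₁ ∞x₀ ∞x₁
  factorisation : CyclicFactorisation
  factorisation with 2 ∣? suc m
  ... | no 2∤N = let Δ₀₀ , Δ₁₁ , Δ₀₁ = odd 2∤N in odd-factorisation Δ₀₀ Δ₁₁ Δ₀₁
  ... | yes 2∣N with half-of-even 2∣N
  ...   | h , h+h≡N = let (P₁ , P₂ , P₃) , Δ₀₀ , Δ₀₁ , Δ₁₁ = even fzero h refl h+h≡N in
                      EvenFactor.even-factorisation m F F-simple F-deg x₀ x₁ ∞x₀ ∞x₁ h h+h≡N P₁ P₂ P₃ Δ₀₀ Δ₀₁ Δ₁₁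
  extension : (C : CycleIn F ℓ) → (∃ λ d → InΔ01 C d × ((h : Fin (suc m)) → toℕ h + toℕ h ≡ suc m → d ≢ h)) →
              OP (ℓ + 1 ∷ rest)
  extension C (_ , (a , b , x , y , ab , a↦x , b↦y , _) , _) =
    subst (λ k → OP (k ∷ rest)) (ℕ.+-comm 1 ℓ) (PermutationSolution⇒OP (Extension.extended-solution
      m F F-simple F-deg x₀ x₁ ∞x₀ ∞x₁ factorisation (suc ℓ ∷ rest) x y
      (subst₂ F a↦x b↦y (CycleIn.edges C a b ab))
      (subst₂ (λ u w → Subdivide F u w ≅ Cyc (suc ℓ ∷ rest)) a↦x b↦y (CycleSubdivision.subdivide-cycle-edge q rest F≅L C a b ab))))
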